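{- Let $G$ be a finite connected bridgeless graph with $\operatorname{cdim}(G)\ge3$. Then for every cycle $C$ of $G$ there exists (the body of) a path segment $P$ such that $C\subseteq G-P$ and $G-P$ is a connected bridgeless graph.
   Context: Graphs are finite, $G=(V,E,r)$, loops and multiple edges allowed. A cycle is a closed walk of length $\ge1$ with no repeated edge and no repeated vertex except first=last, identified with its body; $G(w)$ is the body of a walk $w$. $\mathrm{Cycle}(G)$ is the set of cycle bodies, $\mathrm{Cycle}(v)$ those containing $v$, $G^c$ their union, $\deg_c(v)$ the degree of $v$ in $G^c$ ($0$ if absent). A sign labeling is $f:\mathrm{Cycle}(G)\times E\to\{ -1,0,1\}$ with $f(C,e)=0$ iff $e\notin C$; $\operatorname{cdim}(G)=\min_f\dim\operatorname{span}\{f(C)\}\subseteq\mathbb R^E$. A vertex $v$ is cycle generic if $\deg_c(v)\ge3$ or no vertex $u$ has $\mathrm{Cycle}(v)\subsetneq\mathrm{Cycle}(u)$. A path segment is a walk $(w_0,\dots,w_{2k})$, $k\ge1$, whose body lies in some cycle body, with $w_0,w_{2k}$ cycle generic and $w_2,\dots,w_{2k-2}$ not cycle generic. $G-\bar G$ has edge set $E\setminus\bar E$ and vertex set the vertices of $G$ not in $\bar G$ together with endpoints of edges in $E\setminus\bar E$. -}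

module Defs where

open import Data.Nat using (ℕ; zero; suc; _+_; _≤_)
open import Data.Integer using (ℤ; 0ℤ; 1ℤ; -1ℤ) renaming (_+_ to _+ℤ_; _*_ to _*ℤ_)
open import Data.Fin using (Fin; zero; suc; inject₁; fromℕ; _≟_)
open import Data.Fin.Subset using (Subset; _∈_; _∉_; _⊆_)
open import Data.Vec using (lookup; replicate)
open import Data.Bool using (Bool; true; false; if_then_else_)
open import Data.List using (map; allFin)
open import Data.Nat.ListAction using (sum)
open import Data.Product using (Σ; ∃; ∃-syntax; _×_; _,_; proj₁; proj₂)
open import Data.Sum using (_⊎_)
open import Relation.Nullary using (¬_; does)
open import Relation.Binary.PropositionalEquality using (_≡_; _≢_)
open import Function.Bundles using (_⇔_)
open import Function.Definitions using (Injective)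

-- A finite graph with loops and multiple edges: vertices Fin n, edges Fin m,
-- r e = (the two endpoints of e) (the order is irrelevant, see Joins/Endpoint).
record Graph : Set where
  field
    n : ℕ
    m : ℕ
    r : Fin m → Fin n × Fin n

module _ (G : Graph) where
  open Graph G

  Joins : Fin m → Fin n → Fin n → Set
  Joins e u v = (r e ≡ (u , v)) ⊎ (r e ≡ (v , u))

  Endpoint : Fin m → Fin n → Set
  Endpoint e v = (proj₁ (r e) ≡ v) ⊎ (proj₂ (r e) ≡ v)

  record Walk : Set where
    field
      len : ℕ
      vs  : Fin (suc len) → Fin n
      es  : Fin len → Fin m
      ok  : ∀ i → Joins (es i) (vs (inject₁ i)) (vs (suc i))

  open Walk public

  start end : Walk → Fin n
  start w = vs w zero
  end w = vs w (fromℕ (len w))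

  Sub : Set
  Sub = Subset n × Subset m

  _⊆ₛ_ : Sub → Sub → Set
  S ⊆ₛ T = (proj₁ S ⊆ proj₁ T) × (proj₂ S ⊆ proj₂ T)

  IsBody : Walk → Sub → Set
  IsBody w S = (∀ v → (v ∈ proj₁ S) ⇔ (∃[ i ] vs w i ≡ v))
             × (∀ e → (e ∈ proj₂ S) ⇔ (∃[ i ] es w i ≡ e))

  IsCycleWalk : Walk → Set
  IsCycleWalk w = (1 ≤ len w) × (start w ≡ end w) × Injective _≡_ _≡_ (es w)
                × (∀ i j → vs w (inject₁ i) ≡ vs w (inject₁ j) → i ≡ j)

  IsCycle : Sub → Set
  IsCycle S = ∃[ w ] IsCycleWalk w × IsBody w S

  CycSubset : Fin n → Fin n → Set
  CycSubset v u = ∀ C → IsCycle C → v ∈ proj₁ C → u ∈ proj₁ C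

  CycStrict : Fin n → Fin n → Set
  CycStrict v u = CycSubset v u × (∃[ C ] IsCycle C × u ∈ proj₁ C × v ∉ proj₁ C)

  -- degree of v in the spanning subgraph with edge set ES (a loop counts twice)
  degIn : Subset m → Fin n → ℕ
  degIn ES v = sum (map contrib (allFin m))
    where
      ind : Bool → ℕ
      ind b = if b then 1 else 0
      contrib : Fin m → ℕ
      contrib e = if lookup ES e
                  then ind (does (proj₁ (r e) ≟ v)) + ind (does (proj₂ (r e) ≟ v))
                  else 0

  -- deg_c(v) ≥ 3, where G^c is the union of all cycle bodies
  -- (its edge set EC is uniquely determined by the first conjunct)
  DegC≥3 : Fin n → Set
  DegC≥3 v = ∃[ EC ] (∀ e → (e ∈ EC) ⇔ (∃[ C ] IsCycle C × e ∈ proj₂ C)) × (3 ≤ degIn EC v)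

  CycleGeneric : Fin n → Set
  CycleGeneric v = DegC≥3 v ⊎ (¬ (∃[ u ] CycStrict v u))

  IsPathSegment : Walk → Set
  IsPathSegment w = (1 ≤ len w)
                  × (∃[ P ] IsBody w P × (∃[ C ] IsCycle C × P ⊆ₛ C))
                  × CycleGeneric (start w) × CycleGeneric (end w)
                  × (∀ (i : Fin (suc (len w))) → i ≢ zero → i ≢ fromℕ (len w) → ¬ CycleGeneric (vs w i))

  IsPathSegmentBody : Sub → Set
  IsPathSegmentBody P = ∃[ w ] IsPathSegment w × IsBody w P

  IsMinus : Sub → Sub → Set
  IsMinus P H = (∀ e → (e ∈ proj₂ H) ⇔ (e ∉ proj₂ P))
              × (∀ v → (v ∈ proj₁ H) ⇔ ((v ∉ proj₁ P) ⊎ (∃[ e ] e ∉ proj₂ P × Endpoint e v)))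

  WalkWithin : (Fin n → Set) → (Fin m → Set) → Walk → Set
  WalkWithin PV PE w = (∀ i → PV (vs w i)) × (∀ i → PE (es w i))

  Connected : Sub → Set
  Connected H = ∀ u v → u ∈ proj₁ H → v ∈ proj₁ H →
    ∃[ w ] WalkWithin (_∈ proj₁ H) (_∈ proj₂ H) w × start w ≡ u × end w ≡ v

  IsBridge : Sub → Fin m → Set
  IsBridge H e = e ∈ proj₂ H ×
    ¬ (∃[ w ] WalkWithin (_∈ proj₁ H) (λ e' → e' ∈ proj₂ H × e' ≢ e) w
              × start w ≡ proj₁ (r e) × end w ≡ proj₂ (r e))

  Bridgeless : Sub → Set
  Bridgeless H = ∀ e → ¬ IsBridge H e

  Whole : Sub
  Whole = replicate n true , replicate m true

  -- sign labelings f : Cycle(G) × E → {-1,0,1}; f is given on all subgraphs,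
  -- only its values on cycle bodies matter
  IsSignLabeling : (Sub → Fin m → ℤ) → Set
  IsSignLabeling f = ∀ C → IsCycle C → ∀ e →
    ((f C e ≡ -1ℤ) ⊎ (f C e ≡ 0ℤ) ⊎ (f C e ≡ 1ℤ)) × ((f C e ≡ 0ℤ) ⇔ (e ∉ proj₂ C))

  -- three vectors in ℤ^E linearly independent (equivalently over ℚ or ℝ)
  LinIndep3 : (Fin m → ℤ) → (Fin m → ℤ) → (Fin m → ℤ) → Set
  LinIndep3 x y z = ∀ a b c → (∀ e → (a *ℤ x e) +ℤ (b *ℤ y e) +ℤ (c *ℤ z e) ≡ 0ℤ) →
    (a ≡ 0ℤ) × (b ≡ 0ℤ) × (c ≡ 0ℤ)

  Cdim≥3 : Set
  Cdim≥3 = ∀ f → IsSignLabeling f →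
    ∃[ C₁ ] ∃[ C₂ ] ∃[ C₃ ] IsCycle C₁ × IsCycle C₂ × IsCycle C₃ × LinIndep3 (f C₁) (f C₂) (f C₃)

-- Ear decomposition. Start from H = C and repeatedly attach an ear: an edge leaving the
-- vertices of H followed by a path, found in G minus that edge because G is bridgeless,
-- back to the first vertex of H it meets. Attaching ears keeps H connected and bridgeless.
-- If C were all of G, every cycle would be all of G and cdim G would be at most 1, so
-- there is a first ear; stop at the ear Q that exhausts G. Then G - Q = H is connected,
-- bridgeless and contains C. The inner vertices of Q have degree 2, so every cycle through
-- one of them runs along all of Q, while H has a cycle through an end of Q avoiding them:
-- they are not cycle generic. Each end of Q meets Q and two edges of H (or a loop of H),
-- hence has degree at least 3 in G^c = G. Finally Q closes up to a cycle through a path in H.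
module Submission where

open import Defs
open import Data.Bool using (Bool; true; false; if_then_else_)
open import Data.Empty using (⊥; ⊥-elim)
open import Data.Fin as F using (Fin; zero; suc; inject₁; fromℕ; _≟_; toℕ)
open import Data.Fin.Properties as FP using (any?; pigeonhole)
open import Data.Fin.Subset using (Subset; _∈_; _∉_; _⊆_; _∪_; ∁; ∣_∣)
open import Data.Fin.Subset.Properties
  using (p⊆p∪q; q⊆p∪q; x∈p∪q⁻; x∈∁p⇒x∉p; x∉p⇒x∈∁p; x∉∁p⇒x∈p; nonempty?; p⊂q⇒∣p∣<∣q∣; p⊂q⇒∁p⊃∁q)
  renaming (_∈?_ to _∈S?_)
open import Data.Integer using (ℤ; 0ℤ; 1ℤ; -1ℤ) renaming (_+_ to _+ℤ_; _*_ to _*ℤ_)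
open import Data.List as L using (List; []; _∷_; _++_; length; map)
open import Data.List.Membership.Propositional using () renaming (_∈_ to _∈L_; _∉_ to _∉L_)
open import Data.List.Membership.Propositional.Properties using (∈-++⁺ˡ; ∈-++⁺ʳ; ∈-++⁻; ∈-lookup)
import Data.List.Membership.DecPropositional as DecMembership
open import Data.List.Properties using (++-assoc)
open import Data.List.Relation.Binary.Disjoint.Propositional using (Disjoint)
open import Data.List.Relation.Binary.Subset.Propositional using () renaming (_⊆_ to _⊆L_)
open import Data.List.Relation.Unary.Any using (here; there)
open import Data.Nat using (ℕ; zero; suc; _+_; _≤_; _<_; z≤n; s≤s)
open import Data.Nat.Induction using (<-wellFounded)
open import Data.Nat.ListAction using (sum)
import Data.Nat.Properties as ℕP
open import Algebra.Properties.CommutativeMonoid.Sum ℕP.+-0-commutativeMonoid using (∑-distrib-+) renaming (sum to ∑)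
open import Data.Product as Product using (Σ; ∃-syntax; _×_; _,_; proj₁; proj₂)
open import Data.Product.Properties using (≡-dec)
open import Data.Sum as Sum using (_⊎_; inj₁; inj₂; [_,_])
open import Data.Unit using (⊤; tt)
open import Data.Vec using (lookup; replicate; tabulate)
open import Data.Vec.Properties using ([]=⇒lookup; lookup⇒[]=; lookup-replicate; lookup∘tabulate)
open import Function.Base using (_∘_)
open import Function.Bundles using (_⇔_; mk⇔; Equivalence)
open import Induction.WellFounded using (Acc; acc)
open import Relation.Binary.PropositionalEquality using (_≡_; _≢_; refl; sym; trans; cong; subst)
open import Relation.Nullary using (¬_; Dec; yes; no; does; contradiction)
open import Relation.Nullary.Decidable using (dec-true; dec-false; _×-dec_; _⊎-dec_; ¬?)

private variable
  A : Set

-- A recursive form of the standard library's Unique, which is convenient to pattern match on.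
Distinct : List A → Set
Distinct [] = ⊤
Distinct (x ∷ xs) = x ∉L xs × Distinct xs

Distinct-++⁻ˡ : (xs : List A) {ys : List A} → Distinct (xs ++ ys) → Distinct xs
Distinct-++⁻ˡ [] _ = tt
Distinct-++⁻ˡ (x ∷ xs) (x∉ , d) = (λ x∈ → x∉ (∈-++⁺ˡ x∈)) , Distinct-++⁻ˡ xs d

Distinct-++⁻ʳ : (xs : List A) {ys : List A} → Distinct (xs ++ ys) → Distinct ys
Distinct-++⁻ʳ [] d = d
Distinct-++⁻ʳ (x ∷ xs) (_ , d) = Distinct-++⁻ʳ xs d

Distinct-++⇒Disjoint : (xs : List A) {ys : List A} → Distinct (xs ++ ys) → Disjoint xs ys
Distinct-++⇒Disjoint (x ∷ xs) (x∉ , d) (here refl , a∈ys) = x∉ (∈-++⁺ʳ xs a∈ys)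
Distinct-++⇒Disjoint (x ∷ xs) (x∉ , d) (there a∈ , a∈ys) = Distinct-++⇒Disjoint xs d (a∈ , a∈ys)

Distinct-++⁺ : (xs : List A) {ys : List A} → Distinct xs → Distinct ys → Disjoint xs ys → Distinct (xs ++ ys)
Distinct-++⁺ [] _ dys _ = dys
Distinct-++⁺ (x ∷ xs) (x∉ , dxs) dys disj =
  (λ x∈ → [ x∉ , (λ x∈ys → disj (here refl , x∈ys)) ] (∈-++⁻ xs x∈)) ,
  Distinct-++⁺ xs dxs dys (λ (a∈ , a∈ys) → disj (there a∈ , a∈ys))

Distinct-++-comm : (xs : List A) {ys : List A} → Distinct (xs ++ ys) → Distinct (ys ++ xs)
Distinct-++-comm xs {ys} d = Distinct-++⁺ ys (Distinct-++⁻ʳ xs d) (Distinct-++⁻ˡ xs d)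
  (λ (a∈ys , a∈xs) → Distinct-++⇒Disjoint xs d (a∈xs , a∈ys))

Distinct-lookup-injective : (xs : List A) → Distinct xs → ∀ i j → L.lookup xs i ≡ L.lookup xs j → i ≡ j
Distinct-lookup-injective (x ∷ xs) d zero zero eq = refl
Distinct-lookup-injective (x ∷ xs) (x∉ , _) zero (suc j) eq = ⊥-elim (x∉ (subst (_∈L xs) (sym eq) (∈-lookup j)))
Distinct-lookup-injective (x ∷ xs) (x∉ , _) (suc i) zero eq = ⊥-elim (x∉ (subst (_∈L xs) eq (∈-lookup i)))
Distinct-lookup-injective (x ∷ xs) (_ , d) (suc i) (suc j) eq = cong suc (Distinct-lookup-injective xs d i j eq)

Distinct⇒length≤ : ∀ {k} (xs : List (Fin k)) → Distinct xs → length xs ≤ k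
Distinct⇒length≤ {k} xs d = ℕP.≮⇒≥ λ k<len →
  let (i , j , i<j , eq) = pigeonhole k<len (L.lookup xs) in
  ℕP.<-irrefl (cong toℕ (Distinct-lookup-injective xs d i j eq)) i<j

indicator : Bool → ℕ
indicator b = if b then 1 else 0

δ : ∀ {k} → Fin k → Fin k → ℕ
δ a i = indicator (does (i ≟ a))

δ-diag : ∀ {k} (a : Fin k) → δ a a ≡ 1
δ-diag a rewrite dec-true (a ≟ a) refl = refl

δ-off : ∀ {k} {a i : Fin k} → i ≢ a → δ a i ≡ 0
δ-off {a = a} {i} i≢a rewrite dec-false (i ≟ a) i≢a = refl

sum-map-tabulate : ∀ k (g : Fin k → A) (f : A → ℕ) → sum (map f (L.tabulate g)) ≡ ∑ (f ∘ g)
sum-map-tabulate zero g f = refl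
sum-map-tabulate (suc k) g f = cong (f (g zero) +_) (sum-map-tabulate k (g ∘ suc) f)

∑-mono-≤ : ∀ {k} {f g : Fin k → ℕ} → (∀ i → f i ≤ g i) → ∑ f ≤ ∑ g
∑-mono-≤ {zero} _ = z≤n
∑-mono-≤ {suc k} f≤g = ℕP.+-mono-≤ (f≤g zero) (∑-mono-≤ (f≤g ∘ suc))


∑-zero : ∀ {k} (f : Fin k → ℕ) → (∀ i → f i ≡ 0) → ∑ f ≡ 0
∑-zero {zero} f _ = refl
∑-zero {suc k} f f≡0 rewrite f≡0 zero = ∑-zero (f ∘ suc) (f≡0 ∘ suc)

∑-single : ∀ {k} (a : Fin k) (f : Fin k → ℕ) → f a ≡ 1 → (∀ i → i ≢ a → f i ≡ 0) → ∑ f ≡ 1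
∑-single zero f fa≡1 f≡0 rewrite fa≡1 | ∑-zero (f ∘ suc) (λ i → f≡0 (suc i) λ ()) = refl
∑-single (suc a) f fa≡1 f≡0 rewrite f≡0 zero (λ ()) =
  ∑-single a (f ∘ suc) fa≡1 (λ i i≢a → f≡0 (suc i) (i≢a ∘ FP.suc-injective))

∑-δ : ∀ {k} (a : Fin k) → ∑ (δ a) ≡ 1
∑-δ a = ∑-single a (δ a) (δ-diag a) (λ i → δ-off)

module _ (G : Graph) where
  open Graph G

  open DecMembership {A = Fin n} _≟_ using () renaming (_∈?_ to _∈V?_)
  open DecMembership {A = Fin m} _≟_ using () renaming (_∈?_ to _∈E?_)

  -- Walks

  infix 4 _⇝_
  data _⇝_ : Fin n → Fin n → Set where
    nil : (v : Fin n) → v ⇝ v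
    cons : (u : Fin n) {v t : Fin n} (e : Fin m) → Joins G e u v → v ⇝ t → u ⇝ t

  private variable
    s t u v a b c y s' t' : Fin n
    e d g : Fin m
    D : Sub G

  -- All vertices but the last; for a walk cons x g j w, the list inner w is its interior.
  inner : s ⇝ t → List (Fin n)
  inner (nil _) = []
  inner (cons u _ _ w) = u ∷ inner w

  vertices : s ⇝ t → List (Fin n)
  vertices (nil v) = v ∷ []
  vertices (cons u _ _ w) = u ∷ vertices w

  edges : s ⇝ t → List (Fin m)
  edges (nil _) = []
  edges (cons _ e _ w) = e ∷ edges w

  steps : s ⇝ t → ℕ
  steps (nil _) = 0
  steps (cons _ _ _ w) = suc (steps w)

  infixr 5 _++ʷ_
  _++ʷ_ : s ⇝ t → t ⇝ u → s ⇝ u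
  nil _ ++ʷ w = w
  cons u e j w ++ʷ w' = cons u e j (w ++ʷ w')

  Joins-sym : Joins G e u v → Joins G e v u
  Joins-sym (inj₁ x) = inj₂ x
  Joins-sym (inj₂ x) = inj₁ x

  reverse : s ⇝ t → t ⇝ s
  reverse (nil v) = nil v
  reverse (cons u e j w) = reverse w ++ʷ cons _ e (Joins-sym j) (nil u)

  edges-++ : (w : s ⇝ t) (w' : t ⇝ u) → edges (w ++ʷ w') ≡ edges w ++ edges w'
  edges-++ (nil _) w' = refl
  edges-++ (cons _ e _ w) w' = cong (e ∷_) (edges-++ w w')

  inner-++ : (w : s ⇝ t) (w' : t ⇝ u) → inner (w ++ʷ w') ≡ inner w ++ inner w'
  inner-++ (nil _) w' = refl
  inner-++ (cons u _ _ w) w' = cong (u ∷_) (inner-++ w w')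

  vertices-++ : (w : s ⇝ t) (w' : t ⇝ u) → vertices (w ++ʷ w') ≡ inner w ++ vertices w'
  vertices-++ (nil _) w' = refl
  vertices-++ (cons u _ _ w) w' = cong (u ∷_) (vertices-++ w w')

  vertices≡inner∷ʳend : (w : s ⇝ t) → vertices w ≡ inner w ++ (t ∷ [])
  vertices≡inner∷ʳend (nil _) = refl
  vertices≡inner∷ʳend (cons u _ _ w) = cong (u ∷_) (vertices≡inner∷ʳend w)

  start∈vertices : (w : s ⇝ t) → s ∈L vertices w
  start∈vertices (nil _) = here refl
  start∈vertices (cons _ _ _ _) = here refl


  inner⊆vertices : (w : s ⇝ t) → inner w ⊆L vertices w
  inner⊆vertices (cons u _ _ w) (here refl) = here refl
  inner⊆vertices (cons u _ _ w) (there p) = there (inner⊆vertices w p)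

  end∉inner : (w : s ⇝ t) → Distinct (vertices w) → t ∉L inner w
  end∉inner w d t∈ = Distinct-++⇒Disjoint (inner w) (subst Distinct (vertices≡inner∷ʳend w) d) (t∈ , here refl)

  Distinct-inner : (w : s ⇝ t) → Distinct (vertices w) → Distinct (inner w)
  Distinct-inner w d = Distinct-++⁻ˡ (inner w) (subst Distinct (vertices≡inner∷ʳend w) d)

  ∈edges-++⁻ : (w : s ⇝ t) (w' : t ⇝ u) → e ∈L edges (w ++ʷ w') → e ∈L edges w ⊎ e ∈L edges w'
  ∈edges-++⁻ w w' p rewrite edges-++ w w' = ∈-++⁻ (edges w) p

  ∈edges-++⁺ˡ : (w : s ⇝ t) (w' : t ⇝ u) → edges w ⊆L edges (w ++ʷ w')
  ∈edges-++⁺ˡ w w' p rewrite edges-++ w w' = ∈-++⁺ˡ p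

  ∈edges-++⁺ʳ : (w : s ⇝ t) (w' : t ⇝ u) → edges w' ⊆L edges (w ++ʷ w')
  ∈edges-++⁺ʳ w w' p rewrite edges-++ w w' = ∈-++⁺ʳ (edges w) p

  ∈vertices-++⁻ : (w : s ⇝ t) (w' : t ⇝ u) → v ∈L vertices (w ++ʷ w') → v ∈L vertices w ⊎ v ∈L vertices w'
  ∈vertices-++⁻ w w' p rewrite vertices-++ w w' with ∈-++⁻ (inner w) p
  ... | inj₁ q = inj₁ (inner⊆vertices w q)
  ... | inj₂ q = inj₂ q

  ∈vertices-++⁺ˡ : (w : s ⇝ t) (w' : t ⇝ u) → vertices w ⊆L vertices (w ++ʷ w')
  ∈vertices-++⁺ˡ (nil _) w' (here refl) = start∈vertices w'
  ∈vertices-++⁺ˡ (cons _ _ _ w) w' (here refl) = here refl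
  ∈vertices-++⁺ˡ (cons _ _ _ w) w' (there p) = there (∈vertices-++⁺ˡ w w' p)

  ∈vertices-++⁺ʳ : (w : s ⇝ t) (w' : t ⇝ u) → vertices w' ⊆L vertices (w ++ʷ w')
  ∈vertices-++⁺ʳ w w' p rewrite vertices-++ w w' = ∈-++⁺ʳ (inner w) p

  ∈edges-reverse⁻ : (w : s ⇝ t) → edges (reverse w) ⊆L edges w
  ∈edges-reverse⁻ (cons u e j w) p with ∈edges-++⁻ (reverse w) (cons _ e (Joins-sym j) (nil u)) p
  ... | inj₁ q = there (∈edges-reverse⁻ w q)
  ... | inj₂ (here refl) = here refl

  ∈vertices-reverse⁻ : (w : s ⇝ t) → vertices (reverse w) ⊆L vertices w
  ∈vertices-reverse⁻ (nil _) p = p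
  ∈vertices-reverse⁻ (cons u e j w) p with ∈vertices-++⁻ (reverse w) (cons _ e (Joins-sym j) (nil u)) p
  ... | inj₁ q = there (∈vertices-reverse⁻ w q)
  ... | inj₂ (here refl) = there (start∈vertices w)
  ... | inj₂ (there (here refl)) = here refl

  split-at-vertex : (w : s ⇝ t) → v ∈L vertices w → Σ (s ⇝ v) λ w₁ → Σ (v ⇝ t) λ w₂ → w ≡ w₁ ++ʷ w₂
  split-at-vertex (nil _) (here refl) = nil _ , nil _ , refl
  split-at-vertex (cons u e j w) (here refl) = nil u , cons u e j w , refl
  split-at-vertex (cons u e j w) (there p) with split-at-vertex w p
  ... | w₁ , w₂ , eq = cons u e j w₁ , w₂ , cong (cons u e j) eq

  split-at-edge : (w : s ⇝ t) → e ∈L edges w →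
    ∃[ p ] ∃[ q ] Σ (s ⇝ p) λ w₁ → Σ (Joins G e p q) λ j → Σ (q ⇝ t) λ w₂ → w ≡ w₁ ++ʷ cons p e j w₂
  split-at-edge (cons u e j w) (here refl) = u , _ , nil u , j , w , refl
  split-at-edge (cons u e′ j w) (there x) with split-at-edge w x
  ... | p , q , w₁ , j′ , w₂ , eq = p , q , cons u e′ j w₁ , j′ , w₂ , cong (cons u e′ j) eq

  src tgt : Fin m → Fin n
  src e = proj₁ (r e)
  tgt e = proj₂ (r e)

  Loop : Fin m → Fin n → Set
  Loop e u = src e ≡ u × tgt e ≡ u

  Joins⇒Endpointˡ : Joins G e u v → Endpoint G e u
  Joins⇒Endpointˡ (inj₁ eq) = inj₁ (cong proj₁ eq)
  Joins⇒Endpointˡ (inj₂ eq) = inj₂ (cong proj₂ eq)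

  Joins⇒Endpointʳ : Joins G e u v → Endpoint G e v
  Joins⇒Endpointʳ = Joins⇒Endpointˡ ∘ Joins-sym

  Endpoint-of-Joins : Joins G e a b → Endpoint G e v → v ≡ a ⊎ v ≡ b
  Endpoint-of-Joins (inj₁ eq) (inj₁ p) = inj₁ (trans (sym p) (cong proj₁ eq))
  Endpoint-of-Joins (inj₁ eq) (inj₂ p) = inj₂ (trans (sym p) (cong proj₂ eq))
  Endpoint-of-Joins (inj₂ eq) (inj₁ p) = inj₂ (trans (sym p) (cong proj₁ eq))
  Endpoint-of-Joins (inj₂ eq) (inj₂ p) = inj₁ (trans (sym p) (cong proj₂ eq))

  Joins-ends : Joins G e a b → (src e ≡ a × tgt e ≡ b) ⊎ (src e ≡ b × tgt e ≡ a)
  Joins-ends (inj₁ eq) = inj₁ (cong proj₁ eq , cong proj₂ eq)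
  Joins-ends (inj₂ eq) = inj₂ (cong proj₁ eq , cong proj₂ eq)

  ¬Loop-at-end : Joins G e a c → a ≢ c → ¬ Loop e c
  ¬Loop-at-end j a≢c (p , q) with Joins-ends j
  ... | inj₁ (p′ , _) = a≢c (trans (sym p′) p)
  ... | inj₂ (_ , q′) = a≢c (trans (sym q′) q)

  ¬Loop-at-start : Joins G e c a → a ≢ c → ¬ Loop e c
  ¬Loop-at-start = ¬Loop-at-end ∘ Joins-sym

  endpoint∈vertices : (w : s ⇝ t) → e ∈L edges w → Endpoint G e v → v ∈L vertices w
  endpoint∈vertices (cons u e j w) (here refl) ep with Endpoint-of-Joins j ep
  ... | inj₁ refl = here refl
  ... | inj₂ refl = there (start∈vertices w)
  endpoint∈vertices (cons u _ _ w) (there p) ep = there (endpoint∈vertices w p ep)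

  inner-endpoint : (w : s ⇝ t) → e ∈L edges w → ∃[ u ] u ∈L inner w × Endpoint G e u
  inner-endpoint (cons u e j w) (here refl) = u , here refl , Joins⇒Endpointˡ j
  inner-endpoint (cons u _ _ w) (there p) with inner-endpoint w p
  ... | x , x∈ , ep = x , there x∈ , ep

  first-edge : (w : s ⇝ t) → s ≢ t → ∃[ h ] h ∈L edges w × Endpoint G h s
  first-edge (nil _) s≢t = ⊥-elim (s≢t refl)
  first-edge (cons u e j w) _ = e , here refl , Joins⇒Endpointˡ j

  last-edge-cons : (u : Fin n) (e : Fin m) (j : Joins G e u v) (w : v ⇝ t) →
    ∃[ h ] h ∈L edges (cons u e j w) × Endpoint G h t
  last-edge-cons u e j (nil _) = e , here refl , Joins⇒Endpointʳ j
  last-edge-cons u e j (cons u′ e′ j′ w) with last-edge-cons u′ e′ j′ w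
  ... | h , h∈ , ep = h , there h∈ , ep

  last-edge : (w : s ⇝ t) → s ≢ t → ∃[ h ] h ∈L edges w × Endpoint G h t
  last-edge (nil _) s≢t = ⊥-elim (s≢t refl)
  last-edge (cons u e j w) _ = last-edge-cons u e j w

  cast : s ≡ s' → t ≡ t' → s ⇝ t → s' ⇝ t'
  cast refl refl w = w

  cast-vertices : (p : s ≡ s') (q : t ≡ t') (w : s ⇝ t) → vertices (cast p q w) ≡ vertices w
  cast-vertices refl refl w = refl

  cast-edges : (p : s ≡ s') (q : t ≡ t') (w : s ⇝ t) → edges (cast p q w) ≡ edges w
  cast-edges refl refl w = refl

  cast-inner : (p : s ≡ s') (q : t ≡ t') (w : s ⇝ t) → inner (cast p q w) ≡ inner w
  cast-inner refl refl w = refl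

  cast-steps : (p : s ≡ s') (q : t ≡ t') (w : s ⇝ t) → steps (cast p q w) ≡ steps w
  cast-steps refl refl w = refl

  record Shortcut (w : s ⇝ t) : Set where
    field
      path : s ⇝ t
      distinct : Distinct (vertices path)
      vertices⊆ : vertices path ⊆L vertices w
      edges⊆ : edges path ⊆L edges w

  shortcut : (w : s ⇝ t) → Shortcut w
  shortcut (nil v) = record { path = nil v ; distinct = (λ ()) , tt ; vertices⊆ = λ p → p ; edges⊆ = λ p → p }
  shortcut (cons u e j w) with shortcut w
  ... | record { path = p ; distinct = dp ; vertices⊆ = sv ; edges⊆ = se } with u ∈V? vertices p
  ... | no u∉ = record
    { path = cons u e j p
    ; distinct = u∉ , dp
    ; vertices⊆ = λ { (here refl) → here refl ; (there x) → there (sv x) }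
    ; edges⊆ = λ { (here refl) → here refl ; (there x) → there (se x) } }
  ... | yes u∈ with split-at-vertex p u∈
  ...   | p₁ , p₂ , refl = record
    { path = p₂
    ; distinct = Distinct-++⁻ʳ (inner p₁) (subst Distinct (vertices-++ p₁ p₂) dp)
    ; vertices⊆ = λ x → there (sv (∈vertices-++⁺ʳ p₁ p₂ x))
    ; edges⊆ = λ x → there (se (∈edges-++⁺ʳ p₁ p₂ x)) }

  Distinct-edges : (w : s ⇝ t) → Distinct (vertices w) → Distinct (edges w)
  Distinct-edges (nil _) _ = tt
  Distinct-edges (cons u e j w) (u∉ , d) = (λ e∈ → u∉ (endpoint∈vertices w e∈ (Joins⇒Endpointˡ j))) , Distinct-edges w d

  length-vertices : (w : s ⇝ t) → length (vertices w) ≡ suc (steps w)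
  length-vertices (nil _) = refl
  length-vertices (cons _ _ _ w) = cong suc (length-vertices w)

  steps<n : (w : s ⇝ t) → Distinct (vertices w) → steps w < n
  steps<n w d = subst (_≤ n) (length-vertices w) (Distinct⇒length≤ (vertices w) d)

  vertexAt : (w : s ⇝ t) → Fin (suc (steps w)) → Fin n
  vertexAt (nil v) _ = v
  vertexAt (cons u _ _ w) zero = u
  vertexAt (cons u _ _ w) (suc i) = vertexAt w i

  edgeAt : (w : s ⇝ t) → Fin (steps w) → Fin m
  edgeAt (cons _ e _ w) zero = e
  edgeAt (cons _ _ _ w) (suc i) = edgeAt w i

  vertexAt-zero : (w : s ⇝ t) → vertexAt w zero ≡ s
  vertexAt-zero (nil _) = refl
  vertexAt-zero (cons _ _ _ _) = refl

  vertexAt-last : (w : s ⇝ t) → vertexAt w (fromℕ (steps w)) ≡ t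
  vertexAt-last (nil _) = refl
  vertexAt-last (cons _ _ _ w) = vertexAt-last w

  vertexAt-Joins : (w : s ⇝ t) → ∀ i → Joins G (edgeAt w i) (vertexAt w (inject₁ i)) (vertexAt w (suc i))
  vertexAt-Joins (cons u e j w) zero = subst (Joins G e u) (sym (vertexAt-zero w)) j
  vertexAt-Joins (cons u e j w) (suc i) = vertexAt-Joins w i

  toWalk : s ⇝ t → Walk G
  toWalk w = record { len = steps w ; vs = vertexAt w ; es = edgeAt w ; ok = vertexAt-Joins w }

  vertexAt∈vertices : (w : s ⇝ t) (i : Fin (suc (steps w))) → vertexAt w i ∈L vertices w
  vertexAt∈vertices (nil v) i = here refl
  vertexAt∈vertices (cons u _ _ w) zero = here refl
  vertexAt∈vertices (cons u _ _ w) (suc i) = there (vertexAt∈vertices w i)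

  ∈vertices⇒vertexAt : (w : s ⇝ t) → v ∈L vertices w → ∃[ i ] vertexAt w i ≡ v
  ∈vertices⇒vertexAt (nil v) (here refl) = zero , refl
  ∈vertices⇒vertexAt (cons u _ _ w) (here refl) = zero , refl
  ∈vertices⇒vertexAt (cons u _ _ w) (there p) with ∈vertices⇒vertexAt w p
  ... | i , eq = suc i , eq

  edgeAt∈edges : (w : s ⇝ t) (i : Fin (steps w)) → edgeAt w i ∈L edges w
  edgeAt∈edges (cons _ e _ w) zero = here refl
  edgeAt∈edges (cons _ e _ w) (suc i) = there (edgeAt∈edges w i)

  ∈edges⇒edgeAt : (w : s ⇝ t) → e ∈L edges w → ∃[ i ] edgeAt w i ≡ e
  ∈edges⇒edgeAt (cons _ _ _ w) (here refl) = zero , refl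
  ∈edges⇒edgeAt (cons _ _ _ w) (there p) with ∈edges⇒edgeAt w p
  ... | i , eq = suc i , eq

  vertexAt-inject₁∈inner : (w : s ⇝ t) (i : Fin (steps w)) → vertexAt w (inject₁ i) ∈L inner w
  vertexAt-inject₁∈inner (cons u _ _ w) zero = here refl
  vertexAt-inject₁∈inner (cons u _ _ w) (suc i) = there (vertexAt-inject₁∈inner w i)

  vertexAt∈inner : (w : s ⇝ t) (i : Fin (suc (steps w))) → i ≢ fromℕ (steps w) → vertexAt w i ∈L inner w
  vertexAt∈inner (nil v) zero i≢last = ⊥-elim (i≢last refl)
  vertexAt∈inner (cons u _ _ w) zero _ = here refl
  vertexAt∈inner (cons u _ _ w) (suc i) i≢last = there (vertexAt∈inner w i (i≢last ∘ cong suc))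

  edgeAt-injective : (w : s ⇝ t) → Distinct (edges w) → ∀ {i j} → edgeAt w i ≡ edgeAt w j → i ≡ j
  edgeAt-injective (cons _ e _ w) _ {zero} {zero} eq = refl
  edgeAt-injective (cons _ e _ w) (e∉ , _) {zero} {suc j} eq =
    ⊥-elim (e∉ (subst (_∈L edges w) (sym eq) (edgeAt∈edges w j)))
  edgeAt-injective (cons _ e _ w) (e∉ , _) {suc i} {zero} eq =
    ⊥-elim (e∉ (subst (_∈L edges w) eq (edgeAt∈edges w i)))
  edgeAt-injective (cons _ e _ w) (_ , d) {suc i} {suc j} eq = cong suc (edgeAt-injective w d eq)

  vertexAt-inject₁-injective : (w : s ⇝ t) → Distinct (inner w) →
    ∀ i j → vertexAt w (inject₁ i) ≡ vertexAt w (inject₁ j) → i ≡ j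
  vertexAt-inject₁-injective (cons u _ _ w) _ zero zero eq = refl
  vertexAt-inject₁-injective (cons u _ _ w) (u∉ , _) zero (suc j) eq =
    ⊥-elim (u∉ (subst (_∈L inner w) (sym eq) (vertexAt-inject₁∈inner w j)))
  vertexAt-inject₁-injective (cons u _ _ w) (u∉ , _) (suc i) zero eq =
    ⊥-elim (u∉ (subst (_∈L inner w) eq (vertexAt-inject₁∈inner w i)))
  vertexAt-inject₁-injective (cons u _ _ w) (_ , d) (suc i) (suc j) eq = cong suc (vertexAt-inject₁-injective w d i j eq)

  toWalk-IsCycleWalk : (w : s ⇝ s) → 1 ≤ steps w → Distinct (inner w) → Distinct (edges w) → IsCycleWalk G (toWalk w)
  toWalk-IsCycleWalk w nonempty dᵥ dₑ =
    nonempty , trans (vertexAt-zero w) (sym (vertexAt-last w)) , edgeAt-injective w dₑ , vertexAt-inject₁-injective w dᵥ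

  toSubset : ∀ {k} {P : Fin k → Set} → (∀ x → Dec (P x)) → Subset k
  toSubset P? = tabulate (λ x → does (P? x))

  ∈toSubset⁺ : ∀ {k} {P : Fin k → Set} (P? : ∀ x → Dec (P x)) {x : Fin k} → P x → x ∈ toSubset P?
  ∈toSubset⁺ P? {x} px = lookup⇒[]= x _ (trans (lookup∘tabulate _ x) (dec-true (P? x) px))

  ∈toSubset⁻ : ∀ {k} {P : Fin k → Set} (P? : ∀ x → Dec (P x)) {x : Fin k} → x ∈ toSubset P? → P x
  ∈toSubset⁻ P? {x} x∈ with P? x | trans (sym (lookup∘tabulate _ x)) ([]=⇒lookup x∈)
  ... | yes px | _ = px

  body : s ⇝ t → Sub G
  body w = toSubset (_∈V? vertices w) , toSubset (_∈E? edges w)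

  body-vertices⁺ : (w : s ⇝ t) → v ∈L vertices w → v ∈ proj₁ (body w)
  body-vertices⁺ w = ∈toSubset⁺ (_∈V? vertices w)

  body-vertices⁻ : (w : s ⇝ t) → v ∈ proj₁ (body w) → v ∈L vertices w
  body-vertices⁻ w = ∈toSubset⁻ (_∈V? vertices w)

  body-edges⁺ : (w : s ⇝ t) → e ∈L edges w → e ∈ proj₂ (body w)
  body-edges⁺ w = ∈toSubset⁺ (_∈E? edges w)

  body-edges⁻ : (w : s ⇝ t) → e ∈ proj₂ (body w) → e ∈L edges w
  body-edges⁻ w = ∈toSubset⁻ (_∈E? edges w)

  body-IsBody : (w : s ⇝ t) → IsBody G (toWalk w) (body w)
  body-IsBody w =
      (λ v → mk⇔ (∈vertices⇒vertexAt w ∘ body-vertices⁻ w)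
                 (λ { (i , refl) → body-vertices⁺ w (vertexAt∈vertices w i) }))
    , (λ e → mk⇔ (∈edges⇒edgeAt w ∘ body-edges⁻ w)
                 (λ { (i , refl) → body-edges⁺ w (edgeAt∈edges w i) }))

  fromSequence : (L : ℕ) (f : Fin (suc L) → Fin n) (g : Fin L → Fin m) →
    (∀ i → Joins G (g i) (f (inject₁ i)) (f (suc i))) → f zero ⇝ f (fromℕ L)
  fromSequence zero f g ok = nil (f zero)
  fromSequence (suc L) f g ok =
    cons (f zero) (g zero) (ok zero) (fromSequence L (f ∘ suc) (g ∘ suc) (ok ∘ suc))

  fromSequence-vertices⁻ : ∀ L f g ok → v ∈L vertices (fromSequence L f g ok) → ∃[ i ] f i ≡ v
  fromSequence-vertices⁻ zero f g ok (here refl) = zero , refl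
  fromSequence-vertices⁻ (suc L) f g ok (here refl) = zero , refl
  fromSequence-vertices⁻ (suc L) f g ok (there p) with fromSequence-vertices⁻ L _ _ _ p
  ... | i , eq = suc i , eq

  fromSequence-vertices⁺ : ∀ L f g ok (i : Fin (suc L)) → f i ∈L vertices (fromSequence L f g ok)
  fromSequence-vertices⁺ zero f g ok zero = here refl
  fromSequence-vertices⁺ (suc L) f g ok zero = here refl
  fromSequence-vertices⁺ (suc L) f g ok (suc i) = there (fromSequence-vertices⁺ L _ _ _ i)

  fromSequence-edges⁻ : ∀ L f g ok → e ∈L edges (fromSequence L f g ok) → ∃[ i ] g i ≡ e
  fromSequence-edges⁻ (suc L) f g ok (here refl) = zero , refl
  fromSequence-edges⁻ (suc L) f g ok (there p) with fromSequence-edges⁻ L _ _ _ p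
  ... | i , eq = suc i , eq

  fromSequence-edges⁺ : ∀ L f g ok (i : Fin L) → g i ∈L edges (fromSequence L f g ok)
  fromSequence-edges⁺ (suc L) f g ok zero = here refl
  fromSequence-edges⁺ (suc L) f g ok (suc i) = there (fromSequence-edges⁺ L _ _ _ i)

  fromSequence-inner⁻ : ∀ L f g ok → v ∈L inner (fromSequence L f g ok) → ∃[ i ] f (inject₁ i) ≡ v
  fromSequence-inner⁻ (suc L) f g ok (here refl) = zero , refl
  fromSequence-inner⁻ (suc L) f g ok (there p) with fromSequence-inner⁻ L _ _ _ p
  ... | i , eq = suc i , eq

  fromSequence-steps : ∀ L f g ok → steps (fromSequence L f g ok) ≡ L
  fromSequence-steps zero f g ok = refl
  fromSequence-steps (suc L) f g ok = cong suc (fromSequence-steps L _ _ _)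

  fromSequence-Distinct-inner : ∀ L f g ok → (∀ i j → f (inject₁ i) ≡ f (inject₁ j) → i ≡ j) →
    Distinct (inner (fromSequence L f g ok))
  fromSequence-Distinct-inner zero f g ok inj = tt
  fromSequence-Distinct-inner (suc L) f g ok inj =
    (λ p → let (i , eq) = fromSequence-inner⁻ L _ _ _ p in FP.0≢1+n (sym (inj (suc i) zero eq))) ,
    fromSequence-Distinct-inner L _ _ _ (λ i j eq → FP.suc-injective (inj (suc i) (suc j) eq))

  fromSequence-Distinct-edges : ∀ L f g ok → (∀ {i j} → g i ≡ g j → i ≡ j) → Distinct (edges (fromSequence L f g ok))
  fromSequence-Distinct-edges zero f g ok inj = tt
  fromSequence-Distinct-edges (suc L) f g ok inj =
    (λ p → let (i , eq) = fromSequence-edges⁻ L _ _ _ p in FP.0≢1+n (sym (inj {suc i} {zero} eq))) ,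
    fromSequence-Distinct-edges L _ _ _ (λ eq → FP.suc-injective (inj eq))

  fromWalk : (w : Walk G) → start G w ⇝ end G w
  fromWalk w = fromSequence (Walk.len w) (Walk.vs w) (Walk.es w) (Walk.ok w)

  Joins? : ∀ e u v → Dec (Joins G e u v)
  Joins? e u v = (r e ≟² (u , v)) ⊎-dec (r e ≟² (v , u))
    where _≟²_ = ≡-dec _≟_ _≟_

  Endpoint? : ∀ e v → Dec (Endpoint G e v)
  Endpoint? e v = (src e ≟ v) ⊎-dec (tgt e ≟ v)

  infix 4 _⇝[_]_
  _⇝[_]_ : Fin n → (Fin m → Set) → Fin n → Set
  s ⇝[ P ] t = Σ (s ⇝ t) λ w → ∀ {d} → d ∈L edges w → P d

  module _ {P : Fin m → Set} where

    infixr 5 _++ᴾ_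
    _++ᴾ_ : s ⇝[ P ] t → t ⇝[ P ] u → s ⇝[ P ] u
    (w , pw) ++ᴾ (w′ , pw′) = w ++ʷ w′ , [ pw , pw′ ] ∘ ∈edges-++⁻ w w′

    reverseᴾ : s ⇝[ P ] t → t ⇝[ P ] s
    reverseᴾ (w , pw) = reverse w , pw ∘ ∈edges-reverse⁻ w

    mapᴾ : ∀ {Q : Fin m → Set} → (∀ {d} → P d → Q d) → s ⇝[ P ] t → s ⇝[ Q ] t
    mapᴾ f (w , pw) = w , f ∘ pw

    castᴾ : s ≡ s' → t ≡ t' → s ⇝[ P ] t → s' ⇝[ P ] t'
    castᴾ refl refl w = w

    toEdgeEnds : Joins G e a b → b ⇝[ P ] a → src e ⇝[ P ] tgt e
    toEdgeEnds j w with Joins-ends j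
    ... | inj₁ (p , q) = castᴾ (sym p) (sym q) (reverseᴾ w)
    ... | inj₂ (p , q) = castᴾ (sym p) (sym q) w

    fromEdgeEnds : Joins G e a b → src e ⇝[ P ] tgt e → b ⇝[ P ] a
    fromEdgeEnds j w with Joins-ends j
    ... | inj₁ (p , q) = castᴾ q p (reverseᴾ w)
    ... | inj₂ (p , q) = castᴾ p q w

    walk-of-length? : (∀ d → Dec (P d)) → ∀ L s t → Dec (Σ (s ⇝[ P ] t) λ w → steps (proj₁ w) ≡ L)
    walk-of-length? P? zero s t with s ≟ t
    ... | yes refl = yes ((nil s , λ ()) , refl)
    ... | no s≢t = no λ { ((nil _ , _) , _) → s≢t refl }
    walk-of-length? P? (suc L) s t
      with any? (λ e → any? (λ v → (Joins? e s v ×-dec P? e) ×-dec walk-of-length? P? L v t))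
    ... | yes (e , v , (j , pe) , ((w , pw) , len)) =
          yes ((cons s e j w , λ { (here refl) → pe ; (there x) → pw x }) , cong suc len)
    ... | no ¬step = no λ { ((cons _ e j w , pw) , len) →
          ¬step (e , _ , (j , pw (here refl)) , ((w , pw ∘ there) , ℕP.suc-injective len)) }

    -- Shortcutting bounds the length of a witness by n, so existence is a finite search.
    ⇝[]-stable : (∀ d → Dec (P d)) → ¬ ¬ (s ⇝[ P ] t) → s ⇝[ P ] t
    ⇝[]-stable {s} {t} P? ¬¬w with any? (λ (L : Fin n) → walk-of-length? P? (toℕ L) s t)
    ... | yes (_ , w , _) = w
    ... | no ¬w = ⊥-elim (¬¬w λ (w , pw) →
          let open Shortcut (shortcut w) in
          ¬w (F.fromℕ< (steps<n path distinct) , (path , pw ∘ edges⊆) , sym (FP.toℕ-fromℕ< (steps<n path distinct))))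

  -- Degrees

  -- degreeTerm ES v is literally the summand of degIn ES v, so degIn≡∑ holds by computation.
  endCount : Fin n → Fin m → ℕ
  endCount v e = indicator (does (src e ≟ v)) + indicator (does (tgt e ≟ v))

  degreeTerm : Subset m → Fin n → Fin m → ℕ
  degreeTerm ES v e = if lookup ES e then endCount v e else 0

  degIn≡∑ : ∀ ES v → degIn G ES v ≡ ∑ (degreeTerm ES v)
  degIn≡∑ ES v = sum-map-tabulate m (λ e → e) (degreeTerm ES v)

  degreeTerm≤endCount : ∀ ES v e → degreeTerm ES v e ≤ endCount v e
  degreeTerm≤endCount ES v e with lookup ES e
  ... | true = ℕP.≤-refl
  ... | false = z≤n

  degreeTerm-Whole : ∀ v e → degreeTerm (proj₂ (Whole G)) v e ≡ endCount v e
  degreeTerm-Whole v e rewrite lookup-replicate e true = refl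

  Endpoint⇒1≤endCount : Endpoint G e v → 1 ≤ endCount v e
  Endpoint⇒1≤endCount {e} {v} (inj₁ p) rewrite dec-true (src e ≟ v) p = s≤s z≤n
  Endpoint⇒1≤endCount {e} {v} (inj₂ p) rewrite dec-true (tgt e ≟ v) p = ℕP.m≤n+m 1 _

  Loop⇒endCount≡2 : Loop e v → endCount v e ≡ 2
  Loop⇒endCount≡2 {e} {v} (p , q) rewrite dec-true (src e ≟ v) p | dec-true (tgt e ≟ v) q = refl

  ¬Endpoint⇒endCount≡0 : ¬ Endpoint G e v → endCount v e ≡ 0
  ¬Endpoint⇒endCount≡0 {e} {v} ¬ep
    rewrite dec-false (src e ≟ v) (¬ep ∘ inj₁) | dec-false (tgt e ≟ v) (¬ep ∘ inj₂) = refl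

  ¬Loop⇒endCount≤1 : ¬ Loop e v → endCount v e ≤ 1
  ¬Loop⇒endCount≤1 {e} {v} ¬loop with src e ≟ v | tgt e ≟ v
  ... | yes p | yes q = ⊥-elim (¬loop (p , q))
  ... | yes _ | no _ = s≤s z≤n
  ... | no _ | yes _ = s≤s z≤n
  ... | no _ | no _ = z≤n

  degIn-Whole-≥ : ∀ {v} (f : Fin m → ℕ) → (∀ e → f e ≤ endCount v e) → ∑ f ≤ degIn G (proj₂ (Whole G)) v
  degIn-Whole-≥ {v} f f≤ = subst (∑ f ≤_) (sym (degIn≡∑ (proj₂ (Whole G)) v))
    (∑-mono-≤ λ e → subst (f e ≤_) (sym (degreeTerm-Whole v e)) (f≤ e))

  degIn-≤ : ∀ {ES v} (f : Fin m → ℕ) → (∀ e → degreeTerm ES v e ≤ f e) → degIn G ES v ≤ ∑ f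
  degIn-≤ {ES} {v} f ≤f = subst (_≤ ∑ f) (sym (degIn≡∑ ES v)) (∑-mono-≤ ≤f)

  degree≥3-of-three-edges : ∀ {a b c : Fin m} → a ≢ b → a ≢ c → b ≢ c →
    Endpoint G a v → Endpoint G b v → Endpoint G c v → 3 ≤ degIn G (proj₂ (Whole G)) v
  degree≥3-of-three-edges {v} {a} {b} {c} a≢b a≢c b≢c ea eb ec = subst (_≤ _) ∑≡3 (degIn-Whole-≥ _ bound)
    where
      bound : ∀ e → δ a e + (δ b e + δ c e) ≤ endCount v e
      bound e with e ≟ a
      ... | yes refl rewrite δ-off a≢b | δ-off a≢c = Endpoint⇒1≤endCount ea
      ... | no _ with e ≟ b
      ...   | yes refl rewrite δ-off b≢c = Endpoint⇒1≤endCount eb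
      ...   | no _ with e ≟ c
      ...     | yes refl = Endpoint⇒1≤endCount ec
      ...     | no _ = z≤n
      ∑≡3 : ∑ (λ e → δ a e + (δ b e + δ c e)) ≡ 3
      ∑≡3 rewrite ∑-distrib-+ (δ a) (λ e → δ b e + δ c e) | ∑-distrib-+ (δ b) (δ c)
                | ∑-δ a | ∑-δ b | ∑-δ c = refl

  degree≥3-of-loop-and-edge : ∀ {a b : Fin m} → Loop a v → b ≢ a → Endpoint G b v → 3 ≤ degIn G (proj₂ (Whole G)) v
  degree≥3-of-loop-and-edge {v} {a} {b} loop b≢a eb = subst (_≤ _) ∑≡3 (degIn-Whole-≥ _ bound)
    where
      bound : ∀ e → δ a e + (δ a e + δ b e) ≤ endCount v e
      bound e with e ≟ a
      ... | yes refl rewrite δ-off (b≢a ∘ sym) | Loop⇒endCount≡2 loop = ℕP.≤-refl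
      ... | no _ with e ≟ b
      ...   | yes refl = Endpoint⇒1≤endCount eb
      ...   | no _ = z≤n
      ∑≡3 : ∑ (λ e → δ a e + (δ a e + δ b e)) ≡ 3
      ∑≡3 rewrite ∑-distrib-+ (δ a) (λ e → δ a e + δ b e) | ∑-distrib-+ (δ a) (δ b) | ∑-δ a | ∑-δ b = refl

  degree≤2 : (∀ {h} → Endpoint G h v → h ≡ g ⊎ h ≡ d) → ¬ Loop g v → ¬ Loop d v → ∀ ES → degIn G ES v ≤ 2
  degree≤2 {v} {g} {d} ends ¬loop-g ¬loop-d ES =
    subst (degIn G ES v ≤_) ∑≡2 (degIn-≤ {ES} (λ e → δ g e + δ d e) bound)
    where
      bound : ∀ e → degreeTerm ES v e ≤ δ g e + δ d e
      bound e with e ≟ g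
      ... | yes refl = ℕP.≤-trans (degreeTerm≤endCount ES v e) (ℕP.m≤n⇒m≤n+o _ (¬Loop⇒endCount≤1 ¬loop-g))
      ... | no e≢g with e ≟ d
      ...   | yes refl = ℕP.≤-trans (degreeTerm≤endCount ES v e) (¬Loop⇒endCount≤1 ¬loop-d)
      ...   | no e≢d = ℕP.≤-trans (degreeTerm≤endCount ES v e)
                        (ℕP.≤-reflexive (¬Endpoint⇒endCount≡0 λ ep → [ e≢g , e≢d ] (ends ep)))
      ∑≡2 : ∑ (λ e → δ g e + δ d e) ≡ 2
      ∑≡2 rewrite ∑-distrib-+ (δ g) (δ d) | ∑-δ g | ∑-δ d = refl

  -- Cycles

  record CycleWalk : Set where
    field
      {base} : Fin n
      walk : base ⇝ base
      nonempty : 1 ≤ steps walk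
      distinct-inner : Distinct (inner walk)
      distinct-edges : Distinct (edges walk)

  some-edge : (w : s ⇝ t) → 1 ≤ steps w → ∃[ e ] e ∈L edges w
  some-edge (cons _ e _ _) _ = e , here refl

  TwoEdgesAt : (Fin m → Set) → Fin n → Set
  TwoEdgesAt E u = ∃[ h₁ ] ∃[ h₂ ] E h₁ × E h₂ × Endpoint G h₁ u × Endpoint G h₂ u × (h₁ ≢ h₂ ⊎ Loop h₁ u)

  two-edges-at-base : (w : u ⇝ u) → Distinct (edges w) → e ∈L edges w → TwoEdgesAt (_∈L edges w) u
  two-edges-at-base (cons u h j (nil _)) _ _ = h , h , here refl , here refl , ep , ep , inj₂ loop
    where
      ep = Joins⇒Endpointˡ j
      loop : Loop h u
      loop with Joins-ends j
      ... | inj₁ ends = ends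
      ... | inj₂ ends = ends
  two-edges-at-base (cons u h₁ j (cons u′ h′ j′ w)) (h₁∉ , _) _ with last-edge-cons u′ h′ j′ w
  ... | h₂ , h₂∈ , ep₂ =
    h₁ , h₂ , here refl , there h₂∈ , Joins⇒Endpointˡ j , ep₂ , inj₁ λ { refl → h₁∉ h₂∈ }

  record Rotation (c : s ⇝ s) (u : Fin n) : Set where
    field
      walk : u ⇝ u
      edges⊆ : edges walk ⊆L edges c
      ⊇edges : edges c ⊆L edges walk
      distinct-edges : Distinct (edges c) → Distinct (edges walk)

  rotate : (c : s ⇝ s) → u ∈L vertices c → Rotation c u
  rotate c u∈ with split-at-vertex c u∈
  ... | w₁ , w₂ , refl = record
    { walk = w₂ ++ʷ w₁
    ; edges⊆ = [ ∈edges-++⁺ʳ w₁ w₂ , ∈edges-++⁺ˡ w₁ w₂ ] ∘ ∈edges-++⁻ w₂ w₁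
    ; ⊇edges = [ ∈edges-++⁺ʳ w₂ w₁ , ∈edges-++⁺ˡ w₂ w₁ ] ∘ ∈edges-++⁻ w₁ w₂
    ; distinct-edges = λ d → subst Distinct (sym (edges-++ w₂ w₁))
        (Distinct-++-comm (edges w₁) (subst Distinct (edges-++ w₁ w₂) d)) }

  two-edges-at : (c : CycleWalk) → u ∈L vertices (CycleWalk.walk c) → TwoEdgesAt (_∈L edges (CycleWalk.walk c)) u
  two-edges-at c u∈ with rotate (CycleWalk.walk c) u∈ | some-edge (CycleWalk.walk c) (CycleWalk.nonempty c)
  ... | rot | e , e∈ with two-edges-at-base (Rotation.walk rot) (Rotation.distinct-edges rot (CycleWalk.distinct-edges c))
                            (Rotation.⊇edges rot e∈)
  ... | h₁ , h₂ , h₁∈ , h₂∈ , two = h₁ , h₂ , Rotation.edges⊆ rot h₁∈ , Rotation.edges⊆ rot h₂∈ , two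

  record CycleBody (D : Sub G) : Set where
    field
      cycle : CycleWalk
    open CycleWalk cycle public using (walk)
    field
      vertices⇒ : v ∈L vertices walk → v ∈ proj₁ D
      ⇒vertices : v ∈ proj₁ D → v ∈L vertices walk
      edges⇒ : e ∈L edges walk → e ∈ proj₂ D
      ⇒edges : e ∈ proj₂ D → e ∈L edges walk

    ends-in : e ∈ proj₂ D → Endpoint G e u → u ∈ proj₁ D
    ends-in e∈ ep = vertices⇒ (endpoint∈vertices walk (⇒edges e∈) ep)

    two-edges : u ∈ proj₁ D → TwoEdgesAt (_∈ proj₂ D) u
    two-edges u∈ with two-edges-at cycle (⇒vertices u∈)
    ... | h₁ , h₂ , h₁∈ , h₂∈ , two = h₁ , h₂ , edges⇒ h₁∈ , edges⇒ h₂∈ , two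

    an-edge : ∃[ e ] e ∈ proj₂ D
    an-edge with some-edge walk (CycleWalk.nonempty cycle)
    ... | e , e∈ = e , edges⇒ e∈

  fromWalk-vertices⇔ : (w : Walk G) → IsBody G w D → v ∈L vertices (fromWalk w) ⇔ v ∈ proj₁ D
  fromWalk-vertices⇔ w (bodyᵥ , _) = mk⇔
    (Equivalence.from (bodyᵥ _) ∘ fromSequence-vertices⁻ _ _ _ _)
    (λ v∈ → let (i , eq) = Equivalence.to (bodyᵥ _) v∈ in subst (_∈L _) eq (fromSequence-vertices⁺ _ _ _ _ i))

  fromWalk-edges⇔ : (w : Walk G) → IsBody G w D → e ∈L edges (fromWalk w) ⇔ e ∈ proj₂ D
  fromWalk-edges⇔ w (_ , bodyₑ) = mk⇔
    (Equivalence.from (bodyₑ _) ∘ fromSequence-edges⁻ _ _ _ _)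
    (λ e∈ → let (i , eq) = Equivalence.to (bodyₑ _) e∈ in subst (_∈L _) eq (fromSequence-edges⁺ _ _ _ _ i))

  IsCycle⇒CycleBody : IsCycle G D → CycleBody D
  IsCycle⇒CycleBody (w , (nonempty , closed , injₑ , injᵥ) , isBody) = record
    { cycle = record
      { walk = closedWalk
      ; nonempty = subst (1 ≤_) (sym (trans (cast-steps refl (sym closed) w′) (fromSequence-steps _ _ _ _))) nonempty
      ; distinct-inner = subst Distinct (sym (cast-inner refl (sym closed) w′)) (fromSequence-Distinct-inner _ _ _ _ injᵥ)
      ; distinct-edges = subst Distinct (sym (cast-edges refl (sym closed) w′)) (fromSequence-Distinct-edges _ _ _ _ injₑ) }
    ; vertices⇒ = Equivalence.to (fromWalk-vertices⇔ w isBody) ∘ subst (_ ∈L_) (cast-vertices refl (sym closed) w′)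
    ; ⇒vertices = subst (_ ∈L_) (sym (cast-vertices refl (sym closed) w′)) ∘ Equivalence.from (fromWalk-vertices⇔ w isBody)
    ; edges⇒ = Equivalence.to (fromWalk-edges⇔ w isBody) ∘ subst (_ ∈L_) (cast-edges refl (sym closed) w′)
    ; ⇒edges = subst (_ ∈L_) (sym (cast-edges refl (sym closed) w′)) ∘ Equivalence.from (fromWalk-edges⇔ w isBody) }
    where
      w′ = fromWalk w
      closedWalk : start G w ⇝ start G w
      closedWalk = cast refl (sym closed) w′

  record Chain (g : Fin m) (a : Fin n) {c t : Fin n} (w : c ⇝ t) : Set where
    field
      joins : Joins G g a c
      edges-at-inner : u ∈L inner w → Endpoint G e u → e ∈L (g ∷ edges w)
      start∉inner : a ∉L inner w
      distinct : Distinct (vertices w)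

  module _ {g g′ : Fin m} {j′ : Joins G g′ c b} {w : b ⇝ t} (ch : Chain g a (cons c g′ j′ w)) where
    open Chain ch

    Chain-edges-at-head : Endpoint G e c → e ≡ g ⊎ e ≡ g′
    Chain-edges-at-head ep with edges-at-inner (here refl) ep
    ... | here eq = inj₁ eq
    ... | there (here eq) = inj₂ eq
    ... | there (there e∈) = ⊥-elim (proj₁ distinct (endpoint∈vertices w e∈ ep))

    Chain-no-loop-before-head : ¬ Loop g c
    Chain-no-loop-before-head = ¬Loop-at-end joins λ { refl → start∉inner (here refl) }

    Chain-no-loop-after-head : ¬ Loop g′ c
    Chain-no-loop-after-head = ¬Loop-at-start j′ λ { refl → proj₁ distinct (start∈vertices w) }

    Chain-tail : Chain g′ c w
    Chain-tail = record
      { joins = j′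
      ; edges-at-inner = tail-edges
      ; start∉inner = proj₁ distinct ∘ inner⊆vertices w
      ; distinct = proj₂ distinct }
      where
        tail-edges : u ∈L inner w → Endpoint G e u → e ∈L (g′ ∷ edges w)
        tail-edges u∈ ep with edges-at-inner (there u∈) ep
        ... | there e∈ = e∈
        ... | here refl with Endpoint-of-Joins joins ep
        ...   | inj₁ refl = ⊥-elim (start∉inner (there u∈))
        ...   | inj₂ refl = ⊥-elim (proj₁ distinct (inner⊆vertices w u∈))

  Chain-degree≤2 : {w : c ⇝ t} → Chain g a w → u ∈L inner w → ∀ ES → degIn G ES u ≤ 2
  Chain-degree≤2 {w = cons _ _ _ _} ch (here refl) =
    degree≤2 (Chain-edges-at-head ch) (Chain-no-loop-before-head ch) (Chain-no-loop-after-head ch)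
  Chain-degree≤2 {w = cons _ _ _ _} ch (there u∈) = Chain-degree≤2 (Chain-tail ch) u∈

  -- Walking back along the chain, each vertex has only two edges, so a cycle through it must use both.
  module _ {V : Fin n → Set} {E : Fin m → Set}
           (ends-in : ∀ {e u} → E e → Endpoint G e u → V u)
           (two-edges : ∀ {u} → V u → TwoEdgesAt E u) where

    Chain-forces-edge : {w : c ⇝ t} → Chain g a w → u ∈L inner w → V u → E g
    Chain-forces-edge {w = cons c g′ j′ w} ch u∈ u∈V with two-edges (head∈V u∈ u∈V)
      where
        head∈V : u ∈L inner (cons c g′ j′ w) → V u → V c
        head∈V (here refl) u∈V = u∈V
        head∈V (there u∈) u∈V = ends-in (Chain-forces-edge (Chain-tail ch) u∈ u∈V) (Joins⇒Endpointˡ j′)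
    ... | h₁ , h₂ , h₁∈ , h₂∈ , ep₁ , ep₂ , two with Chain-edges-at-head ch ep₁ | Chain-edges-at-head ch ep₂
    ... | inj₁ refl | _ = h₁∈
    ... | inj₂ _ | inj₁ refl = h₂∈
    ... | inj₂ refl | inj₂ refl = ⊥-elim ([ (λ h₁≢h₁ → h₁≢h₁ refl) , Chain-no-loop-after-head ch ] two)

  record Opening (c : CycleWalk) (e : Fin m) : Set where
    field
      {p q} : Fin n
      joins : Joins G e p q
      path : q ⇝ p
      edges-cases : d ∈L edges (CycleWalk.walk c) → d ≡ e ⊎ d ∈L edges path
      edges⊆ : edges path ⊆L edges (CycleWalk.walk c)
      e∉path : e ∉L edges path
      p∉inner : p ∉L inner path
      distinct : Distinct (vertices path)

  open-at : (c : CycleWalk) → e ∈L edges (CycleWalk.walk c) → Opening c e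
  open-at {e} c e∈ with split-at-edge (CycleWalk.walk c) e∈
  ... | p , q , w₁ , j , w₂ , eq = record
    { joins = j
    ; path = w₂ ++ʷ w₁
    ; edges-cases = cases ∘ subst (λ w → _ ∈L edges w) eq
    ; edges⊆ = subst (λ w → edges (w₂ ++ʷ w₁) ⊆L edges w) (sym eq) ⊆c
    ; e∉path = e∉
    ; p∉inner = p∉
    ; distinct = distinct-path }
    where
      cases : d ∈L edges (w₁ ++ʷ cons p e j w₂) → d ≡ e ⊎ d ∈L edges (w₂ ++ʷ w₁)
      cases d∈ with ∈edges-++⁻ w₁ (cons p e j w₂) d∈
      ... | inj₁ d∈w₁ = inj₂ (∈edges-++⁺ʳ w₂ w₁ d∈w₁)
      ... | inj₂ (here refl) = inj₁ refl
      ... | inj₂ (there d∈w₂) = inj₂ (∈edges-++⁺ˡ w₂ w₁ d∈w₂)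
      ⊆c : edges (w₂ ++ʷ w₁) ⊆L edges (w₁ ++ʷ cons p e j w₂)
      ⊆c d∈ = [ ∈edges-++⁺ʳ w₁ (cons p e j w₂) ∘ there , ∈edges-++⁺ˡ w₁ (cons p e j w₂) ] (∈edges-++⁻ w₂ w₁ d∈)
      edges-distinct : Distinct (edges w₁ ++ e ∷ edges w₂)
      edges-distinct = subst Distinct (trans (cong edges eq) (edges-++ w₁ (cons p e j w₂))) (CycleWalk.distinct-edges c)
      e∉ : e ∉L edges (w₂ ++ʷ w₁)
      e∉ e∈′ with ∈edges-++⁻ w₂ w₁ e∈′
      ... | inj₁ e∈w₂ = proj₁ (Distinct-++⁻ʳ (edges w₁) edges-distinct) e∈w₂
      ... | inj₂ e∈w₁ = Distinct-++⇒Disjoint (edges w₁) edges-distinct (e∈w₁ , here refl)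
      inner-distinct : Distinct ((p ∷ inner w₂) ++ inner w₁)
      inner-distinct = Distinct-++-comm (inner w₁)
        (subst Distinct (trans (cong inner eq) (inner-++ w₁ (cons p e j w₂))) (CycleWalk.distinct-inner c))
      p∉ : p ∉L inner (w₂ ++ʷ w₁)
      p∉ = proj₁ inner-distinct ∘ subst (p ∈L_) (inner-++ w₂ w₁)
      distinct-path : Distinct (vertices (w₂ ++ʷ w₁))
      distinct-path rewrite vertices-++ w₂ w₁ | vertices≡inner∷ʳend w₁ =
        subst Distinct (++-assoc (inner w₂) (inner w₁) (p ∷ []))
          (Distinct-++⁺ (inner w₂ ++ inner w₁) (proj₂ inner-distinct) ((λ ()) , tt)
            λ { (p∈ , here refl) → proj₁ inner-distinct p∈ })

  cycle-through : (w : src e ⇝ tgt e) → e ∉L edges w →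
    Σ (src e ⇝ src e) λ cyc → IsCycle G (body cyc) × e ∈L edges cyc × edges cyc ⊆L e ∷ edges w
  cycle-through {e} w e∉w =
    cyc , (toWalk cyc , toWalk-IsCycleWalk cyc (s≤s z≤n) inner-distinct edges-distinct , body-IsBody cyc) ,
    here refl , λ { (here refl) → here refl ; (there d∈) → there (∈edges-reverse⁻ w (edges⊆ d∈)) }
    where
      open Shortcut (shortcut (reverse w))
      cyc : src e ⇝ src e
      cyc = cons (src e) e (inj₁ refl) path
      inner-distinct : Distinct (inner cyc)
      inner-distinct = end∉inner path distinct , Distinct-inner path distinct
      edges-distinct : Distinct (edges cyc)
      edges-distinct = e∉w ∘ ∈edges-reverse⁻ w ∘ edges⊆ , Distinct-edges path distinct

  -- Ears

  Touches : Subset m → Fin n → Set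
  Touches H v = ∃[ e ] e ∈ H × Endpoint G e v

  Touches? : ∀ H v → Dec (Touches H v)
  Touches? H v = any? (λ e → (e ∈S? H) ×-dec Endpoint? e v)

  vertices-touch : ∀ {H} (w : s ⇝ t) → Touches H s → (∀ {d} → d ∈L edges w → d ∈ H) → v ∈L vertices w → Touches H v
  vertices-touch (nil _) s-touches _ (here refl) = s-touches
  vertices-touch (cons u e j w) s-touches _ (here refl) = s-touches
  vertices-touch (cons u e j w) _ w⊆H (there v∈) =
    vertices-touch w (e , w⊆H (here refl) , Joins⇒Endpointʳ j) (w⊆H ∘ there) v∈

  record IsConnectedBridgeless (H : Subset m) : Set where
    field
      nonempty : ∃[ e ] e ∈ H
      connected : Touches H u → Touches H v → u ⇝[ _∈ H ] v
      bridgeless : e ∈ H → src e ⇝[ (λ d → d ∈ H × d ≢ e) ] tgt e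

  CycleBody⇒IsConnectedBridgeless : CycleBody D → IsConnectedBridgeless (proj₂ D)
  CycleBody⇒IsConnectedBridgeless {D} cb = record
    { nonempty = an-edge
    ; connected = λ u-touches v-touches → reverseᴾ (from-base u-touches) ++ᴾ from-base v-touches
    ; bridgeless = bridgeless }
    where
      open CycleBody cb
      from-base : Touches (proj₂ D) u → CycleWalk.base cycle ⇝[ _∈ proj₂ D ] u
      from-base (e , e∈ , ep) with split-at-vertex walk (⇒vertices (ends-in e∈ ep))
      ... | w₁ , w₂ , refl = w₁ , edges⇒ ∘ ∈edges-++⁺ˡ w₁ w₂
      bridgeless : e ∈ proj₂ D → src e ⇝[ (λ d → d ∈ proj₂ D × d ≢ e) ] tgt e
      bridgeless e∈ = let open Opening (open-at cycle (⇒edges e∈)) in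
        toEdgeEnds joins (path , λ d∈ → edges⇒ (edges⊆ d∈) , λ { refl → e∉path d∈ })

  another-edge-at : ∀ {H} → IsConnectedBridgeless H → d ∈ H → Endpoint G d t → ¬ Loop d t →
    ∃[ d′ ] d′ ∈ H × d′ ≢ d × Endpoint G d′ t
  another-edge-at cb d∈H ep ¬loop with IsConnectedBridgeless.bridgeless cb d∈H | ep
  ... | w , w⊆ | inj₁ refl =
    let (d′ , d′∈ , ep′) = first-edge w (λ eq → ¬loop (refl , sym eq)) in d′ , proj₁ (w⊆ d′∈) , proj₂ (w⊆ d′∈) , ep′
  ... | w , w⊆ | inj₂ refl =
    let (d′ , d′∈ , ep′) = last-edge w (λ eq → ¬loop (eq , refl)) in d′ , proj₁ (w⊆ d′∈) , proj₂ (w⊆ d′∈) , ep′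

  degree≥3-at-attachment : ∀ {H} → IsConnectedBridgeless H → Touches H t → Endpoint G g t → g ∉ H →
    3 ≤ degIn G (proj₂ (Whole G)) t
  degree≥3-at-attachment {t} {g} cb (d , d∈H , ep) ep-g g∉H with (src d ≟ t) ×-dec (tgt d ≟ t)
  ... | yes loop = degree≥3-of-loop-and-edge loop g≢d ep-g
    where g≢d = λ { refl → g∉H d∈H }
  ... | no ¬loop with another-edge-at cb d∈H ep ¬loop
  ...   | d′ , d′∈H , d′≢d , ep′ =
    degree≥3-of-three-edges (λ { refl → g∉H d∈H }) (λ { refl → g∉H d′∈H }) (d′≢d ∘ sym) ep-g ep ep′

  split-trail-at : (w : s ⇝ t) → Distinct (edges w) → e ∈L edges w →
    ∃[ p ] ∃[ q ] Joins G e p q × s ⇝[ (λ d → d ∈L edges w × d ≢ e) ] p × q ⇝[ (λ d → d ∈L edges w × d ≢ e) ] t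
  split-trail-at {e = e} w distinct e∈ with split-at-edge w e∈
  ... | p , q , w₁ , j , w₂ , refl =
    p , q , j
    , (w₁ , λ d∈ → ∈edges-++⁺ˡ w₁ w₂′ d∈ ,
                   λ { refl → Distinct-++⇒Disjoint (edges w₁) edges-distinct (d∈ , here refl) })
    , (w₂ , λ d∈ → ∈edges-++⁺ʳ w₁ w₂′ (there d∈) ,
                   λ { refl → proj₁ (Distinct-++⁻ʳ (edges w₁) edges-distinct) d∈ })
    where
      w₂′ = cons p e j w₂
      edges-distinct : Distinct (edges w₁ ++ edges w₂′)
      edges-distinct = subst Distinct (edges-++ w₁ w₂′) distinct

  record Ear (H : Subset m) : Set where
    field
      {x₀ y₀ z₀} : Fin n
      e₀ : Fin m
      joins : Joins G e₀ x₀ y₀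
      e₀∉H : e₀ ∉ H
      x₀-touches : Touches H x₀
      z₀-touches : Touches H z₀
      path : y₀ ⇝ z₀
      distinct : Distinct (vertices path)
      touches⇒z₀ : v ∈L vertices path → Touches H v → v ≡ z₀
      path∉H : d ∈L edges path → d ∉ H
      e₀∉path : e₀ ∉L edges path

    walk : x₀ ⇝ z₀
    walk = cons x₀ e₀ joins path

    edgeSet : Subset m
    edgeSet = proj₂ (body walk)

    walk∉H : d ∈L edges walk → d ∉ H
    walk∉H (here refl) = e₀∉H
    walk∉H (there d∈) = path∉H d∈

    inner-untouched : u ∈L inner path → ¬ Touches H u
    inner-untouched u∈ u-touches = end∉inner path distinct
      (subst (_∈L inner path) (touches⇒z₀ (inner⊆vertices path u∈) u-touches) u∈)

    distinct-edges : Distinct (edges walk)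
    distinct-edges = e₀∉path , Distinct-edges path distinct

  module _ {H : Subset m} (E : Ear H) where
    open Ear E

    ∈H∪edgeSet⁻ : d ∈ H ∪ edgeSet → d ∈ H ⊎ d ∈L edges walk
    ∈H∪edgeSet⁻ d∈ = Sum.map₂ (body-edges⁻ walk) (x∈p∪q⁻ H edgeSet d∈)

    add-ear : IsConnectedBridgeless H → IsConnectedBridgeless (H ∪ edgeSet)
    add-ear cb = record
      { nonempty = let (d , d∈) = nonempty in d , ∈H′ˡ d∈
      ; connected = λ u-touches v-touches → to-x₀ u-touches ++ᴾ reverseᴾ (to-x₀ v-touches)
      ; bridgeless = bridgeless′ }
      where
        open IsConnectedBridgeless cb
        H′ = H ∪ edgeSet
        ∈H′ˡ : d ∈ H → d ∈ H′
        ∈H′ˡ = p⊆p∪q edgeSet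
        ∈H′ʳ : d ∈L edges walk → d ∈ H′
        ∈H′ʳ = q⊆p∪q H edgeSet ∘ body-edges⁺ walk
        to-x₀ : Touches H′ u → u ⇝[ _∈ H′ ] x₀
        to-x₀ (d , d∈ , ep) with ∈H∪edgeSet⁻ d∈
        ... | inj₁ d∈H = mapᴾ ∈H′ˡ (connected (d , d∈H , ep) x₀-touches)
        ... | inj₂ d∈walk with split-at-vertex walk (endpoint∈vertices walk d∈walk ep)
        ...   | w₁ , w₂ , eq = reverseᴾ (w₁ , ∈H′ʳ ∘ subst (λ w → _ ∈L edges w) (sym eq) ∘ ∈edges-++⁺ˡ w₁ w₂)
        -- The new edges are bypassed through the rest of the ear and a path back through H.
        bridgeless′ : e ∈ H′ → src e ⇝[ (λ d → d ∈ H′ × d ≢ e) ] tgt e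
        bridgeless′ e∈ with ∈H∪edgeSet⁻ e∈
        ... | inj₁ e∈H = mapᴾ (Product.map₁ ∈H′ˡ) (bridgeless e∈H)
        ... | inj₂ e∈walk with split-trail-at walk distinct-edges e∈walk
        ...   | _ , _ , j , before , after = toEdgeEnds j
                  (mapᴾ (Product.map₁ ∈H′ʳ) after
                   ++ᴾ mapᴾ (λ d∈H → ∈H′ˡ d∈H , λ { refl → walk∉H e∈walk d∈H }) (connected z₀-touches x₀-touches)
                   ++ᴾ mapᴾ (Product.map₁ ∈H′ʳ) before)

  record ExitEdge (H : Subset m) : Set where
    field
      {inside outside} : Fin n
      edge : Fin m
      joins : Joins G edge inside outside
      edge∉H : edge ∉ H
      inside-touches : Touches H inside

  exit-edge : ∀ {H} (w : a ⇝ b) → Touches H a → ¬ Touches H b → ExitEdge H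
  exit-edge (nil _) a-touches ¬b-touches = ⊥-elim (¬b-touches a-touches)
  exit-edge {H = H} (cons u e j w) a-touches ¬b-touches with e ∈S? H
  ... | no e∉H = record { joins = j ; edge∉H = e∉H ; inside-touches = a-touches }
  ... | yes e∈H = exit-edge w (e , e∈H , Joins⇒Endpointʳ j) ¬b-touches

  record FirstTouch (H : Subset m) (y : Fin n) (w : y ⇝ t) : Set where
    field
      {z} : Fin n
      prefix : y ⇝ z
      z-touches : Touches H z
      touches⇒z : v ∈L vertices prefix → Touches H v → v ≡ z
      edges⊆ : edges prefix ⊆L edges w

  first-touch : ∀ {H} (w : y ⇝ t) → ¬ Touches H y → Touches H t → FirstTouch H y w
  first-touch (nil _) ¬y-touches t-touches = ⊥-elim (¬y-touches t-touches)
  first-touch {H = H} (cons y {y′} d j w) ¬y-touches t-touches with Touches? H y′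
  ... | yes y′-touches = record
    { prefix = cons y d j (nil y′)
    ; z-touches = y′-touches
    ; touches⇒z = λ { (here refl) y-touches → ⊥-elim (¬y-touches y-touches) ; (there (here refl)) _ → refl }
    ; edges⊆ = λ { (here refl) → here refl } }
  ... | no ¬y′-touches = record
    { prefix = cons y d j prefix
    ; z-touches = z-touches
    ; touches⇒z = λ { (here refl) y-touches → ⊥-elim (¬y-touches y-touches) ; (there v∈) → touches⇒z v∈ }
    ; edges⊆ = λ { (here refl) → here refl ; (there d∈) → there (edges⊆ d∈) } }
    where open FirstTouch (first-touch w ¬y′-touches t-touches)

  minus-vertex? : ∀ P v → Dec ((v ∉ proj₁ P) ⊎ (∃[ e ] e ∉ proj₂ P × Endpoint G e v))
  minus-vertex? P v = ¬? (v ∈S? proj₁ P) ⊎-dec any? (λ e → ¬? (e ∈S? proj₂ P) ×-dec Endpoint? e v)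

  minus : Sub G → Sub G
  minus P = toSubset (minus-vertex? P) , ∁ (proj₂ P)

  minus-IsMinus : ∀ P → IsMinus G P (minus P)
  minus-IsMinus P =
    (λ e → mk⇔ x∈∁p⇒x∉p x∉p⇒x∈∁p) , (λ v → mk⇔ (∈toSubset⁻ (minus-vertex? P)) (∈toSubset⁺ (minus-vertex? P)))

  spanning-cycle-unique : ∀ {C D} → CycleBody C → (∀ e → e ∈ proj₂ C) → CycleBody D → ∀ e → e ∈ proj₂ D
  spanning-cycle-unique {D = D} cbC spanning cbD e = forced (CycleBody.an-edge cbD)
    where
      open Opening (open-at (CycleBody.cycle cbC) (CycleBody.⇒edges cbC (spanning e)))
      open CycleBody cbD using (ends-in; two-edges)
      other-edges : d ≢ e → d ∈L edges path
      other-edges {d} d≢e with edges-cases (CycleBody.⇒edges cbC (spanning d))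
      ... | inj₁ d≡e = ⊥-elim (d≢e d≡e)
      ... | inj₂ d∈ = d∈
      every-edge : ∀ h → h ∈L (e ∷ edges path)
      every-edge h with h ≟ e
      ... | yes h≡e = here h≡e
      ... | no h≢e = there (other-edges h≢e)
      chain : Chain e p path
      chain = record
        { joins = joins
        ; edges-at-inner = λ {_} {h} _ _ → every-edge h
        ; start∉inner = p∉inner
        ; distinct = distinct }
      forced : ∃[ d ] d ∈ proj₂ D → e ∈ proj₂ D
      forced (d , d∈D) with d ≟ e
      ... | yes refl = d∈D
      ... | no d≢e = let (u , u∈ , ep) = inner-endpoint path (other-edges d≢e) in
                     Chain-forces-edge ends-in two-edges chain u∈ (ends-in d∈D ep)

  indicator-labeling : Sub G → Fin m → ℤ
  indicator-labeling S e = if lookup (proj₂ S) e then 1ℤ else 0ℤ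

  indicator-labeling-IsSignLabeling : IsSignLabeling G indicator-labeling
  indicator-labeling-IsSignLabeling S _ e with lookup (proj₂ S) e in eq
  ... | true = inj₂ (inj₂ refl) , mk⇔ (λ ()) (λ e∉ → ⊥-elim (e∉ (lookup⇒[]= e _ eq)))
  ... | false = inj₂ (inj₁ refl) , mk⇔ (λ _ e∈ → contradiction (trans (sym ([]=⇒lookup e∈)) eq) λ ()) (λ _ → refl)

  -- If C contained every edge, every cycle would, so the 0/1 labeling would give all cycles the same vector.
  Cdim≥3⇒edge-outside : ∀ {C} → Cdim≥3 G → IsCycle G C → ∃[ e ] e ∉ proj₂ C
  Cdim≥3⇒edge-outside {C} cdim C-cycle with nonempty? (∁ (proj₂ C))
  ... | yes (e , e∈∁) = e , x∈∁p⇒x∉p e∈∁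
  ... | no ¬outside with cdim indicator-labeling indicator-labeling-IsSignLabeling
  ...   | D₁ , D₂ , D₃ , D₁-cycle , D₂-cycle , _ , independent with independent 1ℤ -1ℤ 0ℤ same-vector
    where
      spanning : ∀ e → e ∈ proj₂ C
      spanning e = x∉∁p⇒x∈p λ e∈∁ → ¬outside (e , e∈∁)
      all-edges : ∀ {D} → IsCycle G D → ∀ e → lookup (proj₂ D) e ≡ true
      all-edges D-cycle e =
        []=⇒lookup (spanning-cycle-unique (IsCycle⇒CycleBody C-cycle) spanning (IsCycle⇒CycleBody D-cycle) e)
      same-vector : ∀ e → 1ℤ *ℤ indicator-labeling D₁ e +ℤ -1ℤ *ℤ indicator-labeling D₂ e
                          +ℤ 0ℤ *ℤ indicator-labeling D₃ e ≡ 0ℤ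
      same-vector e rewrite all-edges D₁-cycle e | all-edges D₂-cycle e with lookup (proj₂ D₃) e
      ... | true = refl
      ... | false = refl
  ... | () , _

  RemovableSegment : Sub G → Sub G → Set
  RemovableSegment C P =
    IsPathSegmentBody G P × (∃[ R ] IsMinus G P R × _⊆ₛ_ G C R × Connected G R × Bridgeless G R)

  module _ (G-connected : Connected G (Whole G)) (G-bridgeless : Bridgeless G (Whole G)) where

    ∈Whole : ∀ x → x ∈ proj₁ (Whole G)
    ∈Whole x = lookup⇒[]= x _ (lookup-replicate x true)

    ∈Whole-edges : ∀ e → e ∈ proj₂ (Whole G)
    ∈Whole-edges e = lookup⇒[]= e _ (lookup-replicate e true)

    walk-between : ∀ u v → u ⇝ v
    walk-between u v with G-connected u v (∈Whole u) (∈Whole v)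
    ... | w , _ , start≡u , end≡v = cast start≡u end≡v (fromWalk w)

    avoiding : ∀ e → src e ⇝[ _≢ e ] tgt e
    avoiding e = ⇝[]-stable (λ d → ¬? (d ≟ e)) λ ¬w →
      G-bridgeless e (∈Whole-edges e , λ (w , (_ , w≢e) , start≡ , end≡) →
        ¬w (castᴾ start≡ end≡ (fromWalk w , λ d∈ →
          let (i , eq) = fromSequence-edges⁻ _ _ _ _ d∈ in subst (_≢ e) eq (proj₂ (w≢e i)))))

    every-edge-on-cycle : ∀ e → ∃[ D ] IsCycle G D × e ∈ proj₂ D
    every-edge-on-cycle e with avoiding e
    ... | w , w≢e with cycle-through w (λ e∈ → w≢e e∈ refl)
    ...   | cyc , cyc-isCycle , e∈cyc , _ = body cyc , cyc-isCycle , body-edges⁺ cyc e∈cyc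

    exit-edge-towards : ∀ {H} → ∃[ d ] d ∈ H → e ∉ H → ExitEdge H
    exit-edge-towards {e} {H} (d , d∈H) e∉H with Touches? H (src e)
    ... | yes src-touches = record { joins = inj₁ refl ; edge∉H = e∉H ; inside-touches = src-touches }
    ... | no ¬src-touches = exit-edge (walk-between (src d) (src e)) (d , d∈H , inj₁ refl) ¬src-touches

    ear-through : ∀ {H} → ExitEdge H → Ear H
    ear-through {H} ex with Touches? H (ExitEdge.outside ex)
    ... | yes y-touches = record
      { e₀ = edge ; joins = joins ; e₀∉H = edge∉H ; x₀-touches = inside-touches ; z₀-touches = y-touches
      ; path = nil _ ; distinct = (λ ()) , tt ; touches⇒z₀ = λ { (here refl) _ → refl }
      ; path∉H = λ () ; e₀∉path = λ () }
      where open ExitEdge ex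
    ... | no ¬y-touches = record
      { e₀ = edge ; joins = joins ; e₀∉H = edge∉H ; x₀-touches = inside-touches ; z₀-touches = z-touches
      ; path = path ; distinct = distinct
      ; touches⇒z₀ = λ v∈ → touches⇒z (vertices⊆ v∈)
      ; path∉H = path∉H
      ; e₀∉path = λ e∈ → proj₂ back (FirstTouch.edges⊆ first (edges⊆ e∈)) refl }
      where
        open ExitEdge ex
        back = fromEdgeEnds joins (avoiding edge)
        first = first-touch (proj₁ back) ¬y-touches inside-touches
        open FirstTouch first using (z-touches; touches⇒z; prefix)
        open Shortcut (shortcut prefix)
        path∉H : d ∈L edges path → d ∉ H
        path∉H d∈ d∈H with inner-endpoint path d∈
        ... | u , u∈ , ep = end∉inner path distinct
          (subst (_∈L inner path) (touches⇒z (vertices⊆ (inner⊆vertices path u∈)) (_ , d∈H , ep)) u∈)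

    module LastEar {H : Subset m} (cb : IsConnectedBridgeless H) (E : Ear H)
                   (covered : ∀ d → d ∈ H ⊎ d ∈L edges (Ear.walk E)) where
      open Ear E
      open IsConnectedBridgeless cb

      ∉walk⇒∈H : d ∉L edges walk → d ∈ H
      ∉walk⇒∈H {d} d∉ = [ (λ d∈H → d∈H) , (λ d∈ → ⊥-elim (d∉ d∈)) ] (covered d)

      attachment-generic : Touches H t → Endpoint G g t → g ∉ H → CycleGeneric G t
      attachment-generic t-touches ep g∉H = inj₁
        (proj₂ (Whole G) , (λ e → mk⇔ (λ _ → every-edge-on-cycle e) (λ _ → ∈Whole-edges e)) ,
         degree≥3-at-attachment cb t-touches ep g∉H)

      inner-edges⊆walk : u ∈L inner path → Endpoint G e u → e ∈L edges walk
      inner-edges⊆walk {e = e} u∈ ep with covered e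
      ... | inj₁ e∈H = ⊥-elim (inner-untouched u∈ (e , e∈H , ep))
      ... | inj₂ e∈ = e∈

      chain : Chain e₀ x₀ path
      chain = record
        { joins = joins
        ; edges-at-inner = inner-edges⊆walk
        ; start∉inner = λ x₀∈ → inner-untouched x₀∈ x₀-touches
        ; distinct = distinct }

      -- Every cycle through an inner vertex uses the whole ear, while H has a cycle through x₀ avoiding it.
      inner-not-generic : u ∈L inner path → ¬ CycleGeneric G u
      inner-not-generic u∈ (inj₁ (EC , _ , 3≤deg)) with ℕP.≤-trans 3≤deg (Chain-degree≤2 chain u∈ EC)
      ... | s≤s (s≤s ())
      inner-not-generic {u} u∈ (inj₂ ¬strict) = ¬strict (x₀ , cycles-through-x₀ , cycle-avoiding-u)
        where
          cycles-through-x₀ : CycSubset G u x₀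
          cycles-through-x₀ D D-cycle u∈D =
            ends-in (Chain-forces-edge ends-in two-edges chain u∈ u∈D) (Joins⇒Endpointˡ joins)
            where open CycleBody (IsCycle⇒CycleBody D-cycle)
          cycle-avoiding-u : ∃[ D ] IsCycle G D × x₀ ∈ proj₁ D × u ∉ proj₁ D
          cycle-avoiding-u with x₀-touches
          ... | d , d∈H , ep with bridgeless d∈H
          ...   | w , w⊆ with cycle-through w (λ d∈ → proj₂ (w⊆ d∈) refl)
          ...     | cyc , cyc-isCycle , d∈cyc , cyc⊆ =
            body cyc , cyc-isCycle , body-vertices⁺ cyc (endpoint∈vertices cyc d∈cyc ep) ,
            λ u∈cyc → inner-untouched u∈ (vertices-touch cyc (d , d∈H , inj₁ refl) cyc⊆H (body-vertices⁻ cyc u∈cyc))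
            where
              cyc⊆H : ∀ {e} → e ∈L edges cyc → e ∈ H
              cyc⊆H e∈ with cyc⊆ e∈
              ... | here refl = d∈H
              ... | there e∈w = proj₁ (w⊆ e∈w)

      ear-cycle : ∃[ D ] IsCycle G D × _⊆ₛ_ G (body walk) D
      ear-cycle = body cyc , (toWalk cyc , toWalk-IsCycleWalk cyc (s≤s z≤n) inner-distinct edges-distinct , body-IsBody cyc)
                , body-vertices⁺ cyc ∘ ∈vertices-++⁺ˡ walk back ∘ body-vertices⁻ walk
                , body-edges⁺ cyc ∘ ∈edges-++⁺ˡ walk back ∘ body-edges⁻ walk
        where
          H-back = connected z₀-touches x₀-touches
          shortened = shortcut (proj₁ H-back)
          back = Shortcut.path shortened
          back-distinct = Shortcut.distinct shortened
          back⊆H : d ∈L edges back → d ∈ H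
          back⊆H = proj₂ H-back ∘ Shortcut.edges⊆ shortened
          back-touches : v ∈L vertices back → Touches H v
          back-touches = vertices-touch back z₀-touches back⊆H
          cyc = walk ++ʷ back
          inner-distinct : Distinct (inner cyc)
          inner-distinct = subst (λ vs → Distinct (x₀ ∷ vs)) (sym (inner-++ path back))
            ( [ Chain.start∉inner chain , end∉inner back back-distinct ] ∘ ∈-++⁻ (inner path)
            , Distinct-++⁺ (inner path) (Distinct-inner path distinct) (Distinct-inner back back-distinct)
                λ (u∈path , u∈back) → inner-untouched u∈path (back-touches (inner⊆vertices back u∈back)) )
          edges-distinct : Distinct (edges cyc)
          edges-distinct = subst (λ es → Distinct (e₀ ∷ es)) (sym (edges-++ path back))
            ( [ e₀∉path , e₀∉H ∘ back⊆H ] ∘ ∈-++⁻ (edges path)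
            , Distinct-++⁺ (edges path) (Distinct-edges path distinct) (Distinct-edges back back-distinct)
                λ (d∈path , d∈back) → path∉H d∈path (back⊆H d∈back) )

      walk-IsPathSegment : IsPathSegment G (toWalk walk)
      walk-IsPathSegment =
        s≤s z≤n , (body walk , body-IsBody walk , ear-cycle) ,
        attachment-generic x₀-touches (Joins⇒Endpointˡ joins) e₀∉H ,
        subst (CycleGeneric G) (sym (vertexAt-last walk)) z₀-generic , interior
        where
          z₀-generic : CycleGeneric G z₀
          z₀-generic = let (g , g∈ , ep) = last-edge-cons x₀ e₀ joins path in
                       attachment-generic z₀-touches ep (walk∉H g∈)
          interior : ∀ i → i ≢ zero → i ≢ fromℕ (steps walk) → ¬ CycleGeneric G (vertexAt walk i)
          interior zero i≢0 _ = ⊥-elim (i≢0 refl)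
          interior (suc i) _ i≢last = inner-not-generic (vertexAt∈inner path i (i≢last ∘ cong suc))

      rest : Sub G
      rest = minus (body walk)

      ∈rest⇒∈H : d ∈ proj₂ rest → d ∈ H
      ∈rest⇒∈H d∈ = ∉walk⇒∈H (x∈∁p⇒x∉p d∈ ∘ body-edges⁺ walk)

      ∈H⇒∈rest : d ∈ H → d ∈ proj₂ rest
      ∈H⇒∈rest d∈H = x∉p⇒x∈∁p λ d∈walk → walk∉H (body-edges⁻ walk d∈walk) d∈H

      ∈rest⇒touches : u ∈ proj₁ rest → Touches H u
      ∈rest⇒touches {u} u∈ with ∈toSubset⁻ (minus-vertex? (body walk)) u∈
      ... | inj₂ (e , e∉walk , ep) = e , ∉walk⇒∈H (e∉walk ∘ body-edges⁺ walk) , ep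
      ... | inj₁ u∉walk with first-edge (walk-between u x₀) (λ { refl → u∉walk (body-vertices⁺ walk (here refl)) })
      ...   | h , _ , ep =
        h , ∉walk⇒∈H (λ h∈ → u∉walk (body-vertices⁺ walk (endpoint∈vertices walk h∈ ep))) , ep

      touches⇒∈rest : Touches H u → u ∈ proj₁ rest
      touches⇒∈rest (e , e∈H , ep) =
        ∈toSubset⁺ (minus-vertex? (body walk)) (inj₂ (e , x∈∁p⇒x∉p (∈H⇒∈rest e∈H) , ep))

      within-rest : ∀ {P Q : Fin m → Set} → (∀ {d} → P d → d ∈ H) → (∀ {d} → P d → Q d) →
        Touches H s → (w : s ⇝[ P ] t) → WalkWithin G (_∈ proj₁ rest) Q (toWalk (proj₁ w))
      within-rest P⇒∈H P⇒Q s-touches (w , w-P) =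
        (λ i → touches⇒∈rest (vertices-touch w s-touches (P⇒∈H ∘ w-P) (vertexAt∈vertices w i))) ,
        (λ i → P⇒Q (w-P (edgeAt∈edges w i)))

      rest-connected : Connected G rest
      rest-connected u v u∈ v∈ = toWalk (proj₁ w) , within-rest (λ d∈ → d∈) ∈H⇒∈rest (∈rest⇒touches u∈) w ,
                                 vertexAt-zero (proj₁ w) , vertexAt-last (proj₁ w)
        where w = connected (∈rest⇒touches u∈) (∈rest⇒touches v∈)

      rest-bridgeless : Bridgeless G rest
      rest-bridgeless e (e∈ , ¬bypass) = ¬bypass (toWalk (proj₁ w) ,
        within-rest proj₁ (Product.map₁ ∈H⇒∈rest) (e , ∈rest⇒∈H e∈ , inj₁ refl) w ,
        vertexAt-zero (proj₁ w) , vertexAt-last (proj₁ w))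
        where w = bridgeless (∈rest⇒∈H e∈)

      removable : ∀ {C} → CycleBody C → proj₂ C ⊆ H → RemovableSegment C (body walk)
      removable cbC C⊆H =
        (toWalk walk , walk-IsPathSegment , body-IsBody walk) , rest , minus-IsMinus (body walk) ,
        ((λ u∈ → let (h , _ , h∈ , _ , ep , _) = CycleBody.two-edges cbC u∈ in touches⇒∈rest (h , C⊆H h∈ , ep)) ,
         ∈H⇒∈rest ∘ C⊆H) ,
        rest-connected , rest-bridgeless

    grow : ∀ {C H} → IsCycle G C → Acc _<_ ∣ ∁ H ∣ → IsConnectedBridgeless H → proj₂ C ⊆ H → ∃[ e ] e ∉ H →
      ∃[ P ] RemovableSegment C P
    grow {C} {H} C-cycle (acc smaller⇒acc) cb C⊆H (e , e∉H)
      with ear-through (exit-edge-towards (IsConnectedBridgeless.nonempty cb) e∉H)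
    ... | E with nonempty? (∁ (H ∪ Ear.edgeSet E))
    ... | no ¬outside = body (Ear.walk E) , LastEar.removable cb E covered (IsCycle⇒CycleBody C-cycle) C⊆H
      where
        covered : ∀ d → d ∈ H ⊎ d ∈L edges (Ear.walk E)
        covered d = ∈H∪edgeSet⁻ E (x∉∁p⇒x∈p λ d∈∁ → ¬outside (d , d∈∁))
    ... | yes (d , d∈∁) = grow C-cycle (smaller⇒acc fewer-outside) (add-ear E cb) (p⊆p∪q _ ∘ C⊆H) (d , x∈∁p⇒x∉p d∈∁)
      where
        open Ear E using (e₀; e₀∉H; walk; edgeSet)
        fewer-outside : ∣ ∁ (H ∪ edgeSet) ∣ < ∣ ∁ H ∣
        fewer-outside =
          p⊂q⇒∣p∣<∣q∣ (p⊂q⇒∁p⊃∁q (p⊆p∪q edgeSet , e₀ , q⊆p∪q H edgeSet (body-edges⁺ walk (here refl)) , e₀∉H))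

proposition3p2 : (G : Graph) → Connected G (Whole G) → Bridgeless G (Whole G) → Cdim≥3 G →
    ∀ C → IsCycle G C →
    ∃[ P ] IsPathSegmentBody G P × (∃[ H ] IsMinus G P H × _⊆ₛ_ G C H × Connected G H × Bridgeless G H)
proposition3p2 G connected bridgeless cdim C C-cycle =
  grow G connected bridgeless C-cycle (<-wellFounded _) (CycleBody⇒IsConnectedBridgeless G (IsCycle⇒CycleBody G C-cycle))
    (λ e∈C → e∈C) (Cdim≥3⇒edge-outside G cdim C-cycle)
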